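{- For any $w \in Y_n$, the number of maximal chains $\mathrm{id}_n \rightharpoonup \cdots \rightharpoonup w$ in $X_n$ equals the number of shifted standard Young tableaux of shape $\lambda_n(w)$.
   Context: $\mathfrak{B}_n$ is the group of bijections $w$ of $[\![n]\!] := \{ -n,\dots,-1,1,\dots,n\}$ with $w(-i)=-w(i)$; $\bar i := -i$, $w_i := w(i)$. $X_n := \{w \in \mathfrak{B}_n \mid w^{ -1}(1) > 0\}$, $\mathrm{id}_n := 12\cdots n$. Order $[\![n]\!]$ by $\bar n < \dots < \bar 1 < 1 < \dots < n$; write $a \ll b$ if some $c$ satisfies $a<c<b$; the cyclic successor $i^+$ is the next element with $n^+ := \bar n$. $\operatorname{cdes}(w) := |\{i\in[\![n]\!] : w(i) > w(i^+)\}|$. For $u,w\in X_n$, $u \rightharpoonup w$ iff one of: (1) $w_1 \ge 2$ and $u = \bar{w_1} w_2 \cdots w_n$; (2) for some $i\in\{1,\dots,n-1\}$, $w_i \ll w_{i+1}$ and $u$ is $w$ with entries in positions $i,i+1$ swapped; (3) $w_n \le \bar 2$ and $u = w_1\cdots w_{n-1}\bar{w_n}$. A maximal chain $\mathrm{id}_n \rightharpoonup \cdots \rightharpoonup w$ is a sequence of elements of $X_n$ starting at $\mathrm{id}_n$, ending at $w$, with consecutive elements related by $\rightharpoonup$. $Y_n := \{w\in X_n \mid \operatorname{cdes}(w^{ -1}) \le 2\}$. For $w\in Y_n$, $\lambda_n(w)$ is the strict partition whose parts are the numbers $n+1-i$ for $i\in[n]$ with $w_i<0$, listed in decreasing order.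 A shifted standard Young tableau of strict shape $\lambda$ is a filling of the shifted diagram of $\lambda$ (row $j$ has $\lambda_j$ boxes and is shifted $j-1$ units to the right) with $1,\dots,|\lambda|$, each once, increasing along rows and columns. -}

module Defs where

open import Data.Bool using (Bool; true; false; _∧_; _∨_; not; T; if_then_else_)
open import Data.Nat as ℕ using (ℕ; zero; suc; _∸_)
open import Data.Integer as ℤ using (ℤ; +_; -[1+_]; -_)
open import Data.List as List using (List; []; _∷_; _++_; map; filter; length; zip; reverse; upTo; concat; drop)
open import Data.List.Properties using (≡-dec)
open import Data.Bool.ListAction using (all; any)
open import Data.Nat.ListAction using (sum)
open import Data.Maybe using (Maybe; just; nothing)
open import Data.Vec as Vec using (Vec; toList; tabulate)
open import Data.Fin as Fin using (Fin; toℕ)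
open import Data.Product using (Σ; _×_; _,_)
open import Relation.Nullary.Decidable using (⌊_⌋)

-- An element w of the hyperoctahedral group B_n is represented by its
-- window  w_1 … w_n  (a Vec ℤ n); the elements of [[n]] are the
-- nonzero integers in [-n, n], and the order  n̄ < … < 1̄ < 1 < … < n
-- is the usual order on ℤ.  Validity of a window (being a signed
-- permutation) is checked by `isSignedPerm`.

posElems : ℕ → List ℤ
posElems n = map (λ k → + suc k) (upTo n)

-- [[n]] listed in increasing order:  n̄, …, 1̄, 1, …, n
elems : ℕ → List ℤ
elems n = reverse (map -_ (posElems n)) ++ posElems n

_∈ᵇ_ : ℤ → List ℤ → Bool
x ∈ᵇ xs = any (λ y → ⌊ x ℤ.≟ y ⌋) xs

_<ᵇ_ : ℤ → ℤ → Bool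
a <ᵇ b = ⌊ a ℤ.<? b ⌋

_≤ᵇ_ : ℤ → ℤ → Bool
a ≤ᵇ b = ⌊ a ℤ.≤? b ⌋

_==_ : List ℤ → List ℤ → Bool
xs == ys = ⌊ ≡-dec ℤ._≟_ xs ys ⌋

distinct : List ℕ → Bool
distinct [] = true
distinct (x ∷ xs) = not (any (λ y → ⌊ x ℕ.≟ y ⌋) xs) ∧ distinct xs

isSignedPerm : (n : ℕ) → List ℤ → Bool
isSignedPerm n ws = ⌊ length ws ℕ.≟ n ⌋ ∧ all (λ x → x ∈ᵇ elems n) ws
                    ∧ distinct (map ℤ.∣_∣ ws)

-- X_n : signed permutations with w⁻¹(1) > 0, i.e. 1 occurs in the window
inX : (n : ℕ) → Vec ℤ n → Bool
inX n w = isSignedPerm n (toList w) ∧ ((+ 1) ∈ᵇ toList w)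

idPerm : (n : ℕ) → Vec ℤ n
idPerm n = tabulate (λ i → + suc (toℕ i))

-- k-th entry (0-based) of a list, junk value 0 out of range
nth : List ℤ → ℕ → ℤ
nth [] _ = + 0
nth (x ∷ xs) zero = x
nth (x ∷ xs) (suc k) = nth xs k

eval : List ℤ → ℤ → ℤ
eval ws (+ zero) = + 0
eval ws (+ suc k) = nth ws k
eval ws -[1+ k ] = - nth ws k

-- first element of a list satisfying p (junk 0 if none)
findFirst : (ℤ → Bool) → List ℤ → ℤ
findFirst p [] = + 0
findFirst p (x ∷ xs) with p x
... | true = x
... | false = findFirst p xs

inverse : (n : ℕ) → List ℤ → ℤ → ℤ
inverse n ws j = findFirst (λ i → ⌊ eval ws i ℤ.≟ j ⌋) (elems n)

cyclicPairs : List ℤ → List (ℤ × ℤ)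
cyclicPairs [] = []
cyclicPairs (x ∷ xs) = zip (x ∷ xs) (xs ++ (x ∷ []))

-- cdes(f) = #{ i ∈ [[n]] : f(i) > f(i⁺) }   (n⁺ = n̄)
cdes : (n : ℕ) → (ℤ → ℤ) → ℕ
cdes n f = length (filter (λ p → f (Data.Product.proj₂ p) ℤ.<? f (Data.Product.proj₁ p))
                           (cyclicPairs (elems n)))

inY : (n : ℕ) → Vec ℤ n → Bool
inY n w = inX n w ∧ ⌊ cdes n (inverse n (toList w)) ℕ.≤? 2 ⌋

_≪[_]_ : ℤ → ℕ → ℤ → Bool
a ≪[ n ] b = any (λ c → (a <ᵇ c) ∧ (c <ᵇ b)) (elems n)

swapAt : ℕ → List ℤ → List ℤ
swapAt zero (x ∷ y ∷ xs) = y ∷ x ∷ xs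
swapAt (suc k) (x ∷ xs) = x ∷ swapAt k xs
swapAt _ xs = xs

negLast : List ℤ → List ℤ
negLast [] = []
negLast (x ∷ []) = - x ∷ []
negLast (x ∷ y ∷ xs) = x ∷ negLast (y ∷ xs)

lastOr0 : List ℤ → ℤ
lastOr0 [] = + 0
lastOr0 (x ∷ []) = x
lastOr0 (x ∷ y ∷ xs) = lastOr0 (y ∷ xs)

rule1 : List ℤ → List ℤ → Bool
rule1 u [] = false
rule1 u (a ∷ ws) = ((+ 2) ≤ᵇ a) ∧ (u == (- a ∷ ws))

-- rule (2): for some i ∈ {1,…,n-1} (0-based k = i-1), w_i ≪ w_{i+1}
-- and u is w with positions i, i+1 swapped
rule2 : (n : ℕ) → List ℤ → List ℤ → Bool
rule2 n u ws = any (λ k → (nth ws k ≪[ n ] nth ws (suc k)) ∧ (u == swapAt k ws))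
                   (upTo (n ∸ 1))

rule3 : List ℤ → List ℤ → Bool
rule3 u [] = false
rule3 u (a ∷ ws) = (lastOr0 (a ∷ ws) ≤ᵇ (- (+ 2))) ∧ (u == negLast (a ∷ ws))

covers : (n : ℕ) → Vec ℤ n → Vec ℤ n → Bool
covers n u w = inX n u ∧ inX n w ∧
  (rule1 (toList u) (toList w) ∨ rule2 n (toList u) (toList w) ∨ rule3 (toList u) (toList w))

chainEndsAt : (n : ℕ) → Vec ℤ n → List (Vec ℤ n) → Vec ℤ n → Bool
chainEndsAt n x [] w = ⌊ ≡-dec ℤ._≟_ (toList x) (toList w) ⌋
chainEndsAt n x (y ∷ ys) w = covers n x y ∧ chainEndsAt n y ys w

isMaxChain : (n : ℕ) → List (Vec ℤ n) → Vec ℤ n → Bool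
isMaxChain n [] w = false
isMaxChain n (x ∷ xs) w = ⌊ ≡-dec ℤ._≟_ (toList x) (toList (idPerm n)) ⌋
  ∧ all (inX n) (x ∷ xs) ∧ chainEndsAt n x xs w

MaxChain : (n : ℕ) → Vec ℤ n → Set
MaxChain n w = Σ (List (Vec ℤ n)) (λ c → T (isMaxChain n c w))

-- λ_n(w): parts n+1-i for i ∈ [n] with w_i < 0, in decreasing order
-- (listing i = 1, …, n in increasing order gives decreasing parts)
lam : (n : ℕ) → Vec ℤ n → List ℕ
lam n w = List.mapMaybe part (zip (upTo n) (toList w))
  where
  -- position k (0-based), i = k+1, part n+1-i = n-k
  part : ℕ × ℤ → Maybe ℕ
  part (k , x) = if x <ᵇ (+ 0) then just (n ∸ k) else nothing

-- Shifted standard Young tableaux.  A filling of the shifted diagram of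
-- λ = (λ_1 > λ_2 > ⋯) is a list of rows; row j (1-based) has λ_j boxes,
-- its k-th box (1-based) lies in column (j-1)+k.

_<ℕᵇ_ : ℕ → ℕ → Bool
a <ℕᵇ b = ⌊ a ℕ.<? b ⌋

increasing : List ℕ → Bool
increasing [] = true
increasing (x ∷ []) = true
increasing (x ∷ y ∷ xs) = (x <ℕᵇ y) ∧ increasing (y ∷ xs)

rowsHaveShape : List ℕ → List (List ℕ) → Bool
rowsHaveShape [] [] = true
rowsHaveShape (l ∷ ls) (r ∷ rs) = ⌊ length r ℕ.≟ l ⌋ ∧ rowsHaveShape ls rs
rowsHaveShape _ _ = false

-- columns increase: box k of row j+1 sits directly below box k+1 of row j
colsIncreasing : List (List ℕ) → Bool
colsIncreasing [] = true
colsIncreasing (r ∷ []) = true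
colsIncreasing (r ∷ r' ∷ rs) =
  all (λ p → Data.Product.proj₁ p <ℕᵇ Data.Product.proj₂ p) (zip (drop 1 r) r')
  ∧ colsIncreasing (r' ∷ rs)

usesEachOnce : ℕ → List ℕ → Bool
usesEachOnce N xs = ⌊ length xs ℕ.≟ N ⌋ ∧ distinct xs
  ∧ all (λ x → (0 <ℕᵇ x) ∧ ((x ℕ.∸ 1) <ℕᵇ N)) xs

isShiftedSYT : List ℕ → List (List ℕ) → Bool
isShiftedSYT λs t = rowsHaveShape λs t ∧ usesEachOnce (sum λs) (concat t)
  ∧ all increasing t ∧ colsIncreasing t

ShiftedSYT : List ℕ → Set
ShiftedSYT λs = Σ (List (List ℕ)) (λ t → T (isShiftedSYT λs t))

module Submission where

open import Defs
open import Data.Nat using (ℕ)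
open import Data.Integer using (ℤ)
open import Data.Vec using (Vec)
open import Data.Bool using (T)
open import Function.Bundles using (_↔_)

open import Data.Bool as Bool using (Bool; true; false; not; _∧_; _∨_; if_then_else_)
open import Data.Bool.Properties using (T-∧; T-∨; T?; T-irrelevant)
open import Data.Bool.ListAction using (all; any)
open import Data.Nat as ℕ using (zero; suc; _+_; _*_; _∸_; _≤_; _<_; z≤n; s≤s)
open import Data.Nat.Properties as ℕP using (+-suc; +-identityʳ; suc-injective)
open import Data.Nat.ListAction using (sum)
open import Data.Integer as ℤ using (+_; -[1+_]; -_; ∣_∣; -<-; -≤-; +<+)
import Data.Integer.Properties as ℤP
open import Data.Fin using (toℕ)
open import Data.Vec as Vec using ([]; _∷_; toList; replicate; tabulate)
open import Data.Vec.Properties as VecP using (tabulate-cong; length-toList; toList-injective; cast-is-id)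
open import Data.Vec.Membership.Propositional using () renaming (_∈_ to _∈ᵛ_)
import Data.Vec.Relation.Unary.Any as VecAny
open import Data.List as List
  using (List; []; _∷_; _++_; [_]; _∷ʳ_; length; concat; filter; zip; drop; last; reverse; upTo; applyUpTo;
         mapMaybe; initLast; _∷ʳ′_)
import Data.List.Properties as ListP
open import Data.List.Properties using (mapMaybe-cong; length-applyUpTo; ++-assoc; length-++)
open import Data.List.Membership.Propositional using (_∈_; _∉_; lose; find)
open import Data.List.Membership.Propositional.Properties
  using (∈-++⁺ˡ; ∈-++⁺ʳ; ∈-++⁻; ∈-map⁺; ∈-map⁻; ∈-upTo⁺; ∈-upTo⁻; ∈-∃++; ∈-applyUpTo⁺)
open import Data.List.Membership.DecPropositional ℕ._≟_ using (_∈?_)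
open import Data.List.Relation.Unary.Any as Any using (Any; here; there)
open import Data.List.Relation.Unary.Any.Properties using (any⁺; any⁻; reverse⁺; reverse⁻)
open import Data.List.Relation.Unary.All as All using (All; []; _∷_)
open import Data.List.Relation.Unary.All.Properties as AllP using (all⁺; all⁻; concat⁻; All¬⇒¬Any; ¬Any⇒All¬)
open import Data.List.Relation.Unary.AllPairs as AllPairs using (AllPairs; []; _∷_)
import Data.List.Relation.Unary.AllPairs.Properties as AllPairsP
open import Data.List.Relation.Unary.Unique.Propositional using (Unique)
open import Data.List.Relation.Unary.Linked as Linked using (Linked; []; [-]; _∷_; _∷′_; head′)
import Data.List.Relation.Unary.Linked.Properties as LinkedP
open import Data.List.Relation.Binary.Pointwise as Pointwise using (Pointwise; []; _∷_)
open import Data.List.Relation.Binary.Prefix.Heterogeneous using (Prefix; []; _∷_)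
open import Data.List.Relation.Binary.Prefix.Heterogeneous.Properties using (fromPointwise; drop⁺)
open import Data.List.Relation.Binary.Subset.Propositional using (_⊆_)
open import Data.List.Relation.Binary.Permutation.Propositional using (_↭_; ↭-refl; ↭-trans; ↭-sym; ↭⇒↭ₛ)
open import Data.List.Relation.Binary.Permutation.Propositional.Properties using (↭-length; shift; All-resp-↭; ++⁺ˡ)
import Data.List.Relation.Binary.Permutation.Setoid.Properties as PermutationSetoid
open import Data.Maybe as Maybe using (Maybe; just; nothing)
open import Data.Maybe.Relation.Binary.Connected using (Connected; just; just-nothing; nothing-just)
open import Data.Product using (Σ; ∃-syntax; _×_; _,_; proj₁; proj₂; uncurry)
open import Data.Product.Function.Dependent.Propositional using (Σ-↔)
open import Data.Product.Function.NonDependent.Propositional using (_×-↔_)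
open import Data.Sum using (_⊎_; inj₁; inj₂) renaming ([_,_] to either)
open import Data.Sum.Function.Propositional using (_⊎-↔_)
open import Data.Empty using (⊥; ⊥-elim)
open import Function using (_∘_; id; case_of_)
open import Function.Bundles using (mk↔ₛ′; _⇔_; mk⇔; Equivalence)
open import Function.Properties.Inverse using (↔-refl; ↔-sym; ↔-trans)
open import Function.Related.TypeIsomorphisms using (Σ-assoc)
open import Relation.Nullary using (¬_; yes; no)
open import Relation.Nullary.Decidable using (⌊_⌋; toWitness; fromWitness)
open import Relation.Nullary.Irrelevant using (Irrelevant)
open import Relation.Binary.Definitions using (DecidableEquality; tri<; tri≈; tri>)
open import Relation.Binary.PropositionalEquality hiding ([_])

open Equivalence

toList-injective′ : ∀ {A : Set} {n} (x y : Vec A n) → toList x ≡ toList y → x ≡ y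
toList-injective′ x y e = trans (sym (cast-is-id refl x)) (toList-injective refl x y e)

T-not⇔¬T : ∀ {b} → T (not b) ⇔ (¬ T b)
T-not⇔¬T {true} = mk⇔ (λ ()) (λ ¬t → ¬t _)
T-not⇔¬T {false} = mk⇔ (λ _ ()) (λ _ → _)

module _ {A : Set} (_≟_ : DecidableEquality A) where

  any-≟⇔∈ : ∀ {x xs} → T (any (λ y → ⌊ x ≟ y ⌋) xs) ⇔ x ∈ xs
  any-≟⇔∈ {x} {xs} = mk⇔ (λ h → Any.map toWitness (any⁻ _ xs h)) (λ m → any⁺ _ (Any.map fromWitness m))

∈ᵇ⇔∈ : ∀ {x : ℤ} {xs} → T (x ∈ᵇ xs) ⇔ x ∈ xs
∈ᵇ⇔∈ = any-≟⇔∈ ℤ._≟_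

distinct⇔Unique : ∀ {xs : List ℕ} → T (distinct xs) ⇔ Unique xs
distinct⇔Unique = mk⇔ to′ from′
  where
  to′ : ∀ {xs} → T (distinct xs) → Unique xs
  to′ {[]} _ = AllPairs.[]
  to′ {x ∷ xs} h with to T-∧ h
  ... | x∉ , rest = ¬Any⇒All¬ xs (to T-not⇔¬T x∉ ∘ from (any-≟⇔∈ ℕ._≟_)) ∷ to′ rest
  from′ : ∀ {xs} → Unique xs → T (distinct xs)
  from′ AllPairs.[] = _
  from′ {x ∷ xs} (x≢ ∷ u) = from T-∧ (from T-not⇔¬T (All¬⇒¬Any x≢ ∘ to (any-≟⇔∈ ℕ._≟_)) , from′ u)

-- The element of Y_n with sign pattern b (true = negative entry): its positive entries
-- are p+1, p+2, … from left to right, its negative entries have absolute values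
-- decreasing from p+k.  The offset p makes the definition structurally recursive.
window : ∀ {k} → ℕ → Vec Bool k → Vec ℤ k
window p [] = []
window {suc k} p (true ∷ b) = -[1+ p + k ] ∷ window p b
window p (false ∷ b) = + suc p ∷ window (suc p) b

shape : ∀ {k} → Vec Bool k → List ℕ
shape [] = List.[]
shape {suc k} (true ∷ b) = suc k List.∷ shape b
shape (false ∷ b) = shape b

private
  part : ℕ → ℕ × ℤ → Maybe ℕ
  part n (i , x) = if x <ᵇ (+ 0) then just (n ∸ i) else nothing

  parts-window : ∀ {k} n p (b : Vec Bool k) (f : ℕ → ℕ) → (∀ i → n ∸ f i ≡ k ∸ i) →
    mapMaybe (part n) (zip (applyUpTo f k) (toList (window p b))) ≡ shape b
  parts-window n p [] f f≗ = refl
  parts-window n p (true ∷ b) f f≗ =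
    cong₂ List._∷_ (f≗ 0) (parts-window n p b (λ i → f (suc i)) (λ i → f≗ (suc i)))
  parts-window n p (false ∷ b) f f≗ = parts-window n (suc p) b (λ i → f (suc i)) (λ i → f≗ (suc i))

lam-window : ∀ {n} (b : Vec Bool n) → lam n (window 0 b) ≡ shape b
lam-window {n} b = trans (mapMaybe-cong (λ _ → refl) (zip (upTo n) (toList (window 0 b))))
                         (parts-window n 0 b (λ i → i) (λ _ → refl))

window-injective : ∀ {k} p (b b′ : Vec Bool k) → window p b ≡ window p b′ → b ≡ b′
window-injective p [] [] _ = refl
window-injective p (true ∷ b) (true ∷ b′) e = cong (true ∷_) (window-injective p b b′ (VecP.∷-injectiveʳ e))
window-injective p (false ∷ b) (false ∷ b′) e =
  cong (false ∷_) (window-injective (suc p) b b′ (VecP.∷-injectiveʳ e))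

window-allFalse : ∀ k p → window p (replicate k false) ≡ tabulate (λ i → + suc (p + toℕ i))
window-allFalse zero p = refl
window-allFalse (suc k) p = cong₂ _∷_ (cong (λ m → + suc m) (sym (+-identityʳ p)))
  (trans (window-allFalse k (suc p)) (tabulate-cong (λ i → cong (λ m → + suc m) (sym (+-suc p (toℕ i))))))

idPerm≡window : ∀ n → idPerm n ≡ window 0 (replicate n false)
idPerm≡window n = sym (window-allFalse n 0)

infix 4 _≡±[1+_]
data _≡±[1+_] : ℤ → ℕ → Set where
  pos : ∀ {m} → + suc m ≡±[1+ m ]
  neg : ∀ {m} → -[1+ m ] ≡±[1+ m ]

∣∣-≡± : ∀ {x m} → x ≡±[1+ m ] → ℤ.∣ x ∣ ≡ suc m
∣∣-≡± pos = refl
∣∣-≡± neg = refl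

∈-elems⇔ : ∀ {n x} → x ∈ elems n ⇔ (∃[ m ] m < n × x ≡±[1+ m ])
∈-elems⇔ {n} = mk⇔ to′ from′
  where
  positives = List.map (λ k → + suc k) (upTo n)
  to′ : ∀ {x} → x ∈ elems n → ∃[ m ] m < n × x ≡±[1+ m ]
  to′ x∈ with ∈-++⁻ (reverse (List.map ℤ.-_ positives)) x∈
  ... | inj₂ x∈⁺ with m , m∈ , refl ← ∈-map⁻ (λ k → + suc k) x∈⁺ = m , ∈-upTo⁻ m∈ , pos
  ... | inj₁ x∈⁻ with y , y∈ , refl ← ∈-map⁻ ℤ.-_ (reverse⁻ {xs = List.map ℤ.-_ positives} x∈⁻)
                 with m , m∈ , refl ← ∈-map⁻ (λ k → + suc k) y∈ = m , ∈-upTo⁻ m∈ , neg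
  from′ : ∀ {x} → (∃[ m ] m < n × x ≡±[1+ m ]) → x ∈ elems n
  from′ (m , m<n , pos) = ∈-++⁺ʳ (reverse (List.map ℤ.-_ positives)) (∈-map⁺ (λ k → + suc k) (∈-upTo⁺ m<n))
  from′ (m , m<n , neg) = ∈-++⁺ˡ (reverse⁺ (∈-map⁺ ℤ.-_ (∈-map⁺ (λ k → + suc k) (∈-upTo⁺ m<n))))

window-entry : ∀ {k} p (b : Vec Bool k) {x} → x ∈ toList (window p b) →
               ∃[ m ] p ≤ m × m < p + k × x ≡±[1+ m ]
window-entry {suc k} p (true ∷ b) (here refl) = p + k , ℕP.m≤m+n p k , ℕP.+-monoʳ-< p ℕP.≤-refl , neg
window-entry {suc k} p (true ∷ b) (there x∈) with m , p≤m , m< , x≡ ← window-entry p b x∈ =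
  m , p≤m , ℕP.<-trans m< (ℕP.+-monoʳ-< p ℕP.≤-refl) , x≡
window-entry {suc k} p (false ∷ b) (here refl) = p , ℕP.≤-refl , ℕP.m<m+n p (s≤s z≤n) , pos
window-entry {suc k} p (false ∷ b) (there x∈) with m , p<m , m< , x≡ ← window-entry (suc p) b x∈ =
  m , ℕP.<⇒≤ p<m , subst (m <_) (sym (+-suc p k)) m< , x≡

window-unique : ∀ {k} p (b : Vec Bool k) → Unique (List.map ℤ.∣_∣ (toList (window p b)))
window-unique p [] = AllPairs.[]
window-unique {suc k} p (true ∷ b) = All.tabulate fresh ∷ window-unique p b
  where
  fresh : ∀ {y} → y ∈ List.map ℤ.∣_∣ (toList (window p b)) → suc (p + k) ≢ y
  fresh y∈ refl with x , x∈ , y≡ ← ∈-map⁻ ℤ.∣_∣ y∈ with m , _ , m< , x≡ ← window-entry p b x∈ =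
    ℕP.<-irrefl (sym (ℕP.suc-injective (trans y≡ (∣∣-≡± x≡)))) m<
window-unique {suc k} p (false ∷ b) = All.tabulate fresh ∷ window-unique (suc p) b
  where
  fresh : ∀ {y} → y ∈ List.map ℤ.∣_∣ (toList (window (suc p) b)) → suc p ≢ y
  fresh y∈ refl with x , x∈ , y≡ ← ∈-map⁻ ℤ.∣_∣ y∈ with m , p<m , _ , x≡ ← window-entry (suc p) b x∈ =
    ℕP.<-irrefl (ℕP.suc-injective (trans y≡ (∣∣-≡± x≡))) p<m

+suc∈window⇔ : ∀ {k} p (b : Vec Bool k) → + suc p ∈ toList (window p b) ⇔ false ∈ᵛ b
+suc∈window⇔ p b = mk⇔ (to′ b) (from′ b)
  where
  to′ : ∀ {k} (b : Vec Bool k) → + suc p ∈ toList (window p b) → false ∈ᵛ b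
  to′ (true ∷ b) (there e) = VecAny.there (to′ b e)
  to′ (false ∷ b) _ = VecAny.here refl
  from′ : ∀ {k} (b : Vec Bool k) → false ∈ᵛ b → + suc p ∈ toList (window p b)
  from′ (true ∷ b) (VecAny.there f) = there (from′ b f)
  from′ (false ∷ b) _ = here refl

inX-window : ∀ {n} (b : Vec Bool n) → false ∈ᵛ b → T (inX n (window 0 b))
inX-window {n} b f∈b = from T-∧ (signedPerm , from ∈ᵇ⇔∈ (from (+suc∈window⇔ 0 b) f∈b))
  where
  ws = toList (window 0 b)
  entries : T (all (λ x → x ∈ᵇ elems n) ws)
  entries = all⁻ _ (All.tabulate λ x∈ → let m , _ , m<n , x≡ = window-entry 0 b x∈ in
                                        from ∈ᵇ⇔∈ (from ∈-elems⇔ (m , m<n , x≡)))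
  signedPerm : T (isSignedPerm n ws)
  signedPerm = from (T-∧ {⌊ List.length ws ℕ.≟ n ⌋}) (fromWitness (length-toList (window 0 b)) ,
                         from T-∧ (entries , from distinct⇔Unique (window-unique 0 b)))

initLast-∷ʳ : ∀ {A : Set} (ys : List A) y → initLast (ys ∷ʳ y) ≡ ys ∷ʳ′ y
initLast-∷ʳ [] y = refl
initLast-∷ʳ (x ∷ ys) y rewrite initLast-∷ʳ ys y = refl

module _ {n : ℕ} where

  private
    V = Vec ℤ n

  sameList⇔≡ : ∀ {x y : V} → T ⌊ ListP.≡-dec ℤ._≟_ (toList x) (toList y) ⌋ ⇔ x ≡ y
  sameList⇔≡ {x} {y} = mk⇔ (λ h → trans (sym (cast-is-id refl x)) (toList-injective refl x y (toWitness h))) (fromWitness ∘ cong toList)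

  covers⇒inX : ∀ (u w : V) → T (covers n u w) → T (inX n u) × T (inX n w)
  covers⇒inX u w h with inXu , rest ← to (T-∧ {inX n u}) h = inXu , proj₁ (to (T-∧ {inX n w}) rest)

  isMaxChain⇔ : ∀ (x : V) xs w →
    T (isMaxChain n (x ∷ xs) w) ⇔ (x ≡ idPerm n × T (all (inX n) (x ∷ xs)) × T (chainEndsAt n x xs w))
  isMaxChain⇔ x xs w = mk⇔
    (λ h → let x≡id , rest = to (T-∧ {⌊ ListP.≡-dec ℤ._≟_ (toList x) (toList (idPerm n)) ⌋}) h
           in to sameList⇔≡ x≡id , to (T-∧ {all (inX n) (x ∷ xs)}) rest)
    (λ (x≡id , rest) → from T-∧ (from sameList⇔≡ x≡id , from (T-∧ {all (inX n) (x ∷ xs)}) rest))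

  chainEndsAt-[]⇔ : ∀ (x w : V) → T (chainEndsAt n x [] w) ⇔ x ≡ w
  chainEndsAt-[]⇔ x w = sameList⇔≡

  chainEndsAt-∷ʳ : ∀ (x : V) ys u z w →
    T (chainEndsAt n x (ys ∷ʳ u ∷ʳ z) w) ⇔ (T (chainEndsAt n x (ys ∷ʳ u) u) × T (covers n u z) × z ≡ w)
  chainEndsAt-∷ʳ x [] u z w = mk⇔
    (λ h → let x⇀u , rest = to (T-∧ {covers n x u}) h ; u⇀z , z≡w = to (T-∧ {covers n u z}) rest
           in from T-∧ (x⇀u , from (chainEndsAt-[]⇔ u u) refl) , u⇀z , to (chainEndsAt-[]⇔ z w) z≡w)
    (λ (h , u⇀z , z≡w) → from T-∧ (proj₁ (to (T-∧ {covers n x u}) h) , from T-∧ (u⇀z , from (chainEndsAt-[]⇔ z w) z≡w)))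
  chainEndsAt-∷ʳ x (y ∷ ys) u z w = mk⇔
    (λ h → let x⇀y , rest = to T-∧ h ; h′ , u⇀z , z≡w = to (chainEndsAt-∷ʳ y ys u z w) rest
           in from T-∧ (x⇀y , h′) , u⇀z , z≡w)
    (λ (h , u⇀z , z≡w) → let x⇀y , h′ = to (T-∧ {covers n x y}) h
                         in from T-∧ (x⇀y , from (chainEndsAt-∷ʳ y ys u z w) (h′ , u⇀z , z≡w)))

  private
    all-∷ʳ : ∀ {p : V → Bool} xs z → T (all p (xs ∷ʳ z)) ⇔ (T (all p xs) × T (p z))
    all-∷ʳ {p} xs z = mk⇔
      (λ h → let pxs , pz = AllP.++⁻ xs (all⁺ p (xs ∷ʳ z) h) in all⁻ p pxs , All.head pz)
      (λ (pxs , pz) → all⁻ p (AllP.++⁺ (all⁺ p xs pxs) (pz ∷ All.[])))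

  isMaxChain-∷ʳ : ∀ vs (u z w : V) →
    T (isMaxChain n (vs ∷ʳ u ∷ʳ z) w) ⇔ (T (isMaxChain n (vs ∷ʳ u) u) × T (covers n u z) × z ≡ w)
  isMaxChain-∷ʳ [] u z w = mk⇔
    (λ h → let u≡id , inXs , ends = to (isMaxChain⇔ u (z ∷ []) w) h ; u⇀z , z≡w = to (T-∧ {covers n u z}) ends
           in from (isMaxChain⇔ u [] u) (u≡id , from T-∧ (proj₁ (to (T-∧ {inX n u}) inXs) , _) , from (chainEndsAt-[]⇔ u u) refl) ,
              u⇀z , to (chainEndsAt-[]⇔ z w) z≡w)
    (λ (h , u⇀z , z≡w) → let u≡id , _ = to (isMaxChain⇔ u [] u) h ; inX-u , inX-z = covers⇒inX u z u⇀z
      in from (isMaxChain⇔ u (z ∷ []) w) (u≡id , from (T-∧ {inX n u}) (inX-u , from (T-∧ {inX n z}) (inX-z , _)) ,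
                                          from T-∧ (u⇀z , from (chainEndsAt-[]⇔ z w) z≡w)))
  isMaxChain-∷ʳ (x ∷ vs) u z w = mk⇔
    (λ h → let x≡id , inXs , ends = to (isMaxChain⇔ x (vs ∷ʳ u ∷ʳ z) w) h
               ends′ , u⇀z , z≡w = to (chainEndsAt-∷ʳ x vs u z w) ends
           in from (isMaxChain⇔ x (vs ∷ʳ u) u) (x≡id , proj₁ (to (all-∷ʳ (x ∷ vs ∷ʳ u) z) inXs) , ends′) , u⇀z , z≡w)
    (λ (h , u⇀z , z≡w) → let x≡id , inXs , ends = to (isMaxChain⇔ x (vs ∷ʳ u) u) h
      in from (isMaxChain⇔ x (vs ∷ʳ u ∷ʳ z) w)
              (x≡id , from (all-∷ʳ (x ∷ vs ∷ʳ u) z) (inXs , proj₂ (covers⇒inX u z u⇀z)) ,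
               from (chainEndsAt-∷ʳ x vs u z w) (ends , u⇀z , z≡w)))

  maxChain-ends : ∀ vs (z w : V) → T (isMaxChain n (vs ∷ʳ z) w) → z ≡ w
  maxChain-ends vs z w h with initLast vs
  ... | [] = to (chainEndsAt-[]⇔ z w) (proj₂ (proj₂ (to (isMaxChain⇔ z [] w) h)))
  ... | us ∷ʳ′ u = proj₂ (proj₂ (to (isMaxChain-∷ʳ us u z w) h))

  MaxChainInit : V → Set
  MaxChainInit w = Σ (List V) (λ vs → T (isMaxChain n (vs ∷ʳ w) w))

  maxChain↔init : ∀ (w : V) → MaxChain n w ↔ MaxChainInit w
  maxChain↔init w = mk↔ₛ′ to′ from′ to∘from from∘to
    where
    to′ : MaxChain n w → MaxChainInit w
    to′ (c , p) with initLast c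
    ... | vs ∷ʳ′ z = vs , subst (λ z → T (isMaxChain n (vs ∷ʳ z) w)) (maxChain-ends vs z w p) p
    from′ : MaxChainInit w → MaxChain n w
    from′ (vs , q) = vs ∷ʳ w , q
    to∘from : ∀ y → to′ (from′ y) ≡ y
    to∘from (vs , q) rewrite initLast-∷ʳ vs w = cong (vs ,_) (T-irrelevant _ _)
    from∘to : ∀ x → from′ (to′ x) ≡ x
    from∘to (c , p) with initLast c
    ... | vs ∷ʳ′ z with refl ← maxChain-ends vs z w p = refl

  maxChainInit-step : ∀ (w : V) → MaxChainInit w ↔
    (T (isMaxChain n (w ∷ []) w) ⊎ Σ V (λ u → T (covers n u w) × MaxChainInit u))
  maxChainInit-step w = mk↔ₛ′ to′ from′ to∘from from∘to
    where
    to′ : MaxChainInit w → _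
    to′ (vs , p) with initLast vs
    ... | [] = inj₁ p
    ... | us ∷ʳ′ u with q , u⇀w , _ ← to (isMaxChain-∷ʳ us u w w) p = inj₂ (u , u⇀w , us , q)
    from′ : _ → MaxChainInit w
    from′ (inj₁ p) = [] , p
    from′ (inj₂ (u , u⇀w , us , q)) = us ∷ʳ u , from (isMaxChain-∷ʳ us u w w) (q , u⇀w , refl)
    to∘from : ∀ y → to′ (from′ y) ≡ y
    to∘from (inj₁ p) = refl
    to∘from (inj₂ (u , u⇀w , us , q)) rewrite initLast-∷ʳ us u =
      cong₂ (λ c q → inj₂ (u , c , us , q)) (T-irrelevant _ _) (T-irrelevant _ _)
    from∘to : ∀ x → from′ (to′ x) ≡ x
    from∘to (vs , p) with initLast vs
    ... | [] = refl
    ... | us ∷ʳ′ u = cong (us ∷ʳ u ,_) (T-irrelevant _ _)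

  maxChain-step : ∀ (w : V) → MaxChain n w ↔
    (T (isMaxChain n (w ∷ []) w) ⊎ Σ V (λ u → T (covers n u w) × MaxChain n u))
  maxChain-step w = ↔-trans (maxChain↔init w) (↔-trans (maxChainInit-step w)
    (↔-refl ⊎-↔ Σ-↔ ↔-refl (↔-refl ×-↔ ↔-sym (maxChain↔init _))))

-- The corners of the shifted diagram of shape b: a pattern true,false (the part at the
-- true can shrink by one) or a final true (a part equal to 1).
data Corner : ∀ {k} → Vec Bool k → Set where
  swapHere : ∀ {k} {b : Vec Bool k} → Corner (true ∷ false ∷ b)
  endHere : Corner (true ∷ [])
  next : ∀ {k x} {b : Vec Bool k} → Corner b → Corner (x ∷ b)

removeCorner : ∀ {k} {b : Vec Bool k} → Corner b → Vec Bool k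
removeCorner (swapHere {b = b}) = false ∷ true ∷ b
removeCorner endHere = false ∷ []
removeCorner (next {x = x} c) = x ∷ removeCorner c

removeCorner-injective : ∀ {k} {b : Vec Bool k} (c c′ : Corner b) → removeCorner c ≡ removeCorner c′ → c ≡ c′
removeCorner-injective swapHere swapHere _ = refl
removeCorner-injective endHere endHere _ = refl
removeCorner-injective (next c) (next c′) e =
  cong next (removeCorner-injective c c′ (VecP.∷-injectiveʳ e))
removeCorner-injective swapHere (next c′) ()
removeCorner-injective (next c) swapHere ()
removeCorner-injective (next ()) endHere _
removeCorner-injective endHere (next ()) _

false∈removeCorner : ∀ {k} {b : Vec Bool k} (c : Corner b) → false ∈ᵛ removeCorner c
false∈removeCorner swapHere = VecAny.here refl
false∈removeCorner endHere = VecAny.here refl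
false∈removeCorner (next {x = true} c) = VecAny.there (false∈removeCorner c)
false∈removeCorner (next {x = false} c) = VecAny.here refl

isEnd : ∀ {k} {b : Vec Bool k} → Corner b → Bool
isEnd swapHere = false
isEnd endHere = true
isEnd (next c) = isEnd c

position : ∀ {k} {b : Vec Bool k} → Corner b → ℕ
position swapHere = 0
position endHere = 0
position (next c) = suc (position c)

positives : ∀ {k} → Vec Bool k → ℕ
positives [] = 0
positives (true ∷ b) = positives b
positives (false ∷ b) = suc (positives b)

swapAt-window : ∀ {k} p {b : Vec Bool k} (c : Corner b) → ¬ T (isEnd c) →
                swapAt (position c) (toList (window p b)) ≡ toList (window p (removeCorner c))
swapAt-window p (swapHere {k} {b}) _ =
  cong (λ m → + suc p List.∷ -[1+ m ] List.∷ toList (window (suc p) b)) (+-suc p k)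
swapAt-window p endHere ¬end = ⊥-elim (¬end _)
swapAt-window p (next {x = true} c) ¬end = cong (_ List.∷_) (swapAt-window p c ¬end)
swapAt-window p (next {x = false} c) ¬end = cong (_ List.∷_) (swapAt-window (suc p) c ¬end)

suc-position< : ∀ {k} {b : Vec Bool k} (c : Corner b) → ¬ T (isEnd c) → suc (position c) < k
suc-position< swapHere _ = s≤s (s≤s z≤n)
suc-position< endHere ¬end = ⊥-elim (¬end _)
suc-position< (next c) ¬end = s≤s (suc-position< c ¬end)

≪⇔between : ∀ {n a b} → T (a ≪[ n ] b) ⇔ (∃[ c ] c ∈ elems n × a ℤ.< c × c ℤ.< b)
≪⇔between {n} {a} {b} = mk⇔
  (λ h → let c , c∈ , a<c∧c<b = find (any⁻ _ (elems n) h) ; a<c , c<b = to (T-∧ {a <ᵇ c}) a<c∧c<b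
         in c , c∈ , toWitness a<c , toWitness c<b)
  (λ (c , c∈ , a<c , c<b) → any⁺ _ (lose c∈ (from (T-∧ {a <ᵇ c} {c <ᵇ b}) (fromWitness a<c , fromWitness c<b))))

window-≪-at-position : ∀ {n k} p {b : Vec Bool k} (c : Corner b) → ¬ T (isEnd c) → 0 < n →
  let ws = toList (window p b) in T (nth ws (position c) ≪[ n ] nth ws (suc (position c)))
window-≪-at-position {n} p (swapHere {k}) _ 0<n =
  from (≪⇔between {n}) (-[1+ 0 ] , from ∈-elems⇔ (0 , 0<n , neg) , -<- (ℕP.<-≤-trans (s≤s z≤n) (ℕP.m≤n+m (suc k) p)) , ℤ.-<+)
window-≪-at-position p endHere ¬end _ = ⊥-elim (¬end _)
window-≪-at-position p (next {x = true} c) ¬end 0<n = window-≪-at-position p c ¬end 0<n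
window-≪-at-position p (next {x = false} c) ¬end 0<n = window-≪-at-position (suc p) c ¬end 0<n

private
  lastOr0-∷window : ∀ h {k} p (b : Vec Bool (suc k)) →
                    lastOr0 (h List.∷ toList (window p b)) ≡ lastOr0 (toList (window p b))
  lastOr0-∷window h p (true ∷ b) = refl
  lastOr0-∷window h p (false ∷ b) = refl

  negLast-∷window : ∀ h {k} p (b : Vec Bool (suc k)) →
                    negLast (h List.∷ toList (window p b)) ≡ h List.∷ negLast (toList (window p b))
  negLast-∷window h p (true ∷ b) = refl
  negLast-∷window h p (false ∷ b) = refl

lastOr0-window : ∀ {k} p {b : Vec Bool k} (c : Corner b) → T (isEnd c) →
                 lastOr0 (toList (window p b)) ≡ -[1+ p + positives b ]
lastOr0-window p endHere _ = refl
lastOr0-window p (next {x = true} {b = b@(_ ∷ _)} c) end = trans (lastOr0-∷window _ p b) (lastOr0-window p c end)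
lastOr0-window p (next {x = false} {b = b@(_ ∷ _)} c) end =
  trans (lastOr0-∷window _ (suc p) b) (trans (lastOr0-window (suc p) c end) (cong -[1+_] (sym (+-suc p _))))

negLast-window : ∀ {k} p {b : Vec Bool k} (c : Corner b) → T (isEnd c) →
                 negLast (toList (window p b)) ≡ toList (window p (removeCorner c))
negLast-window p endHere _ = cong (λ m → + suc m List.∷ List.[]) (ℕP.+-identityʳ p)
negLast-window p (next {x = true} {b = b@(_ ∷ _)} c) end = trans (negLast-∷window _ p b) (cong (_ List.∷_) (negLast-window p c end))
negLast-window p (next {x = false} {b = b@(_ ∷ _)} c) end =
  trans (negLast-∷window _ (suc p) b) (cong (_ List.∷_) (negLast-window (suc p) c end))

positives>0 : ∀ {k} {b : Vec Bool k} → false ∈ᵛ b → 0 < positives b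
positives>0 {b = true ∷ b} (VecAny.there f∈) = positives>0 f∈
positives>0 {b = false ∷ b} _ = s≤s z≤n

private
  rule3⇐ : ∀ us ws → 0 < List.length ws → T (lastOr0 ws ≤ᵇ -[1+ 1 ]) → us ≡ negLast ws → T (rule3 us ws)
  rule3⇐ us (x List.∷ ws) _ last≤ e = from T-∧ (last≤ , fromWitness e)

  suc-< : ∀ {d m} → d < m ∸ 1 → suc d < m
  suc-< {m = suc m} d< = s≤s d<

  rule3⇒ : ∀ us ws → T (rule3 us ws) → T (lastOr0 ws ≤ᵇ -[1+ 1 ]) × us ≡ negLast ws
  rule3⇒ us (x List.∷ ws) h with last≤ , e ← to (T-∧ {lastOr0 (x List.∷ ws) ≤ᵇ -[1+ 1 ]}) h = last≤ , toWitness e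

corner⇒covers : ∀ {n} {b : Vec Bool n} → false ∈ᵛ b → (c : Corner b) →
                T (covers n (window 0 (removeCorner c)) (window 0 b))
corner⇒covers {n} {b} f∈b c =
  from T-∧ (inX-window (removeCorner c) (false∈removeCorner c) , from T-∧ (inX-window b f∈b , rules (T? (isEnd c))))
  where
  us = toList (window 0 (removeCorner c))
  ws = toList (window 0 b)
  0<n : 0 < n
  0<n = ℕP.<-≤-trans (s≤s z≤n) (suc-position≤ c)
    where
    suc-position≤ : ∀ {k} {b : Vec Bool k} (c : Corner b) → suc (position c) ≤ k
    suc-position≤ swapHere = s≤s z≤n
    suc-position≤ endHere = s≤s z≤n
    suc-position≤ (next c) = s≤s (suc-position≤ c)
  rules : Relation.Nullary.Dec (T (isEnd c)) → T (rule1 us ws ∨ rule2 n us ws ∨ rule3 us ws)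
  rules (no ¬end) = from (T-∨ {rule1 us ws}) (inj₂ (from (T-∨ {rule2 n us ws}) (inj₁
    (any⁺ _ (lose (∈-upTo⁺ (ℕP.suc[m]≤n⇒m≤pred[n] (suc-position< c ¬end)))
                  (from T-∧ (window-≪-at-position 0 c ¬end 0<n , fromWitness (sym (swapAt-window 0 c ¬end)))))))))
  rules (yes end) = from (T-∨ {rule1 us ws}) (inj₂ (from (T-∨ {rule2 n us ws}) (inj₂
    (rule3⇐ us ws (subst (0 <_) (sym (length-toList (window 0 b))) 0<n)
      (subst (λ z → T (z ≤ᵇ -[1+ 1 ])) (sym (lastOr0-window 0 c end)) (fromWitness (-≤- (positives>0 f∈b))))
      (sym (negLast-window 0 c end))))))

private
  nothing-between-+ : ∀ m c → + m ℤ.< c → c ℤ.< + suc m → ⊥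
  nothing-between-+ m (+ j) (+<+ m<j) (+<+ j<1+m) = ℕP.<-irrefl refl (ℕP.≤-trans m<j (ℕP.≤-pred j<1+m))

  nothing-between-- : ∀ m c → -[1+ suc m ] ℤ.< c → c ℤ.< -[1+ m ] → ⊥
  nothing-between-- m -[1+ j ] (-<- j<1+m) (-<- m<j) = ℕP.<-irrefl refl (ℕP.≤-trans m<j (ℕP.≤-pred j<1+m))

  nothing-between-+- : ∀ m m′ c → + m ℤ.< c → c ℤ.< -[1+ m′ ] → ⊥
  nothing-between-+- m m′ (+ j) _ ()
  nothing-between-+- m m′ -[1+ j ] () _

rule1-window : ∀ {n} us (b : Vec Bool n) → ¬ T (rule1 us (toList (window 0 b)))
rule1-window us (true ∷ b) ()
rule1-window us (false ∷ b) ()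

rule2-window⇒corner : ∀ {n k} d p (b : Vec Bool k) → suc d < k →
  let ws = toList (window p b) in T (nth ws d ≪[ n ] nth ws (suc d)) →
  Σ (Corner b) (λ c → swapAt d ws ≡ toList (window p (removeCorner c)))
rule2-window⇒corner {k = suc (suc k)} zero p (true ∷ false ∷ b) _ _ =
  swapHere , cong (λ m → + suc p List.∷ -[1+ m ] List.∷ toList (window (suc p) b)) (+-suc p k)
rule2-window⇒corner {n} {suc (suc k)} zero p (true ∷ true ∷ b) _ h with c , _ , a<c , c<b ← to (≪⇔between {n}) h =
  ⊥-elim (nothing-between-- (p + k) c (subst (λ m → -[1+ m ] ℤ.< c) (+-suc p k) a<c) c<b)
rule2-window⇒corner {n} zero p (false ∷ true ∷ b) _ h with _ , _ , a<c , c<b ← to (≪⇔between {n}) h =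
  ⊥-elim (nothing-between-+- _ _ _ a<c c<b)
rule2-window⇒corner {n} zero p (false ∷ false ∷ b) _ h with _ , _ , a<c , c<b ← to (≪⇔between {n}) h =
  ⊥-elim (nothing-between-+ _ _ a<c c<b)
rule2-window⇒corner zero p (_ ∷ []) (s≤s ()) _
rule2-window⇒corner {n} (suc d) p (true ∷ b) (s≤s d<k) h with c , e ← rule2-window⇒corner {n} d p b d<k h =
  next c , cong (_ List.∷_) e
rule2-window⇒corner {n} (suc d) p (false ∷ b) (s≤s d<k) h with c , e ← rule2-window⇒corner {n} d (suc p) b d<k h =
  next c , cong (_ List.∷_) e

rule3-window⇒corner : ∀ {k} p (b : Vec Bool k) → T (lastOr0 (toList (window p b)) ≤ᵇ -[1+ 1 ]) →
  Σ (Corner b) (λ c → negLast (toList (window p b)) ≡ toList (window p (removeCorner c)))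
rule3-window⇒corner p (true ∷ []) _ = endHere , cong (λ m → + suc m List.∷ List.[]) (ℕP.+-identityʳ p)
rule3-window⇒corner p (true ∷ b@(_ ∷ _)) h
  with c , e ← rule3-window⇒corner p b (subst (λ z → T (z ≤ᵇ -[1+ 1 ])) (lastOr0-∷window _ p b) h) =
  next c , trans (negLast-∷window _ p b) (cong (_ List.∷_) e)
rule3-window⇒corner p (false ∷ b@(_ ∷ _)) h
  with c , e ← rule3-window⇒corner (suc p) b (subst (λ z → T (z ≤ᵇ -[1+ 1 ])) (lastOr0-∷window _ (suc p) b) h) =
  next c , trans (negLast-∷window _ (suc p) b) (cong (_ List.∷_) e)

covers⇒corner : ∀ {n} (b : Vec Bool n) (u : Vec ℤ n) → T (covers n u (window 0 b)) →
                Σ (Corner b) (λ c → window 0 (removeCorner c) ≡ u)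
covers⇒corner {n} b u h with to (T-∨ {rule1 us ws}) (proj₂ (to (T-∧ {inX n w}) (proj₂ (to (T-∧ {inX n u}) h))))
  where us = toList u ; w = window 0 b ; ws = toList w
... | inj₁ r1 = ⊥-elim (rule1-window (toList u) b r1)
... | inj₂ r23 with to (T-∨ {rule2 n (toList u) (toList (window 0 b))}) r23
... | inj₁ r2 with d , d∈ , q ← find (any⁻ _ (upTo (n ∸ 1)) r2)
                 with d≪ , u≡ ← to (T-∧ {nth (toList (window 0 b)) d ≪[ n ] nth (toList (window 0 b)) (suc d)}) q
                 with c , e ← rule2-window⇒corner {n} d 0 b (suc-< (∈-upTo⁻ d∈)) d≪ =
  c , toList-injective′ _ _ (trans (sym e) (sym (toWitness u≡)))
... | inj₂ r3 with last≤ , u≡ ← rule3⇒ (toList u) (toList (window 0 b)) r3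
              with c , e ← rule3-window⇒corner 0 b last≤ =
  c , toList-injective′ _ _ (trans (sym e) (sym u≡))

corner↔covers : ∀ {n} (b : Vec Bool n) → false ∈ᵛ b →
                Corner b ↔ Σ (Vec ℤ n) (λ u → T (covers n u (window 0 b)))
corner↔covers {n} b f∈b = mk↔ₛ′ to′ from′ to∘from from∘to
  where
  Covering = Σ (Vec ℤ n) (λ u → T (covers n u (window 0 b)))
  to′ : Corner b → Covering
  to′ c = window 0 (removeCorner c) , corner⇒covers f∈b c
  from′ : Covering → Corner b
  from′ (u , h) = proj₁ (covers⇒corner b u h)
  to∘from : ∀ y → to′ (from′ y) ≡ y
  to∘from (u , h) with c , refl ← covers⇒corner b u h = cong (u ,_) (T-irrelevant (corner⇒covers f∈b c) h)
  from∘to : ∀ c → from′ (to′ c) ≡ c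
  from∘to c = unique (covers⇒corner b _ (corner⇒covers f∈b c))
    where
    unique : (r : Σ (Corner b) (λ c′ → window 0 (removeCorner c′) ≡ window 0 (removeCorner c))) → proj₁ r ≡ c
    unique (c′ , e) = removeCorner-injective c′ c (window-injective 0 _ _ e)

private
  irrelevant⇔⇒↔ : ∀ {A B : Set} → Irrelevant A → Irrelevant B → A ⇔ B → A ↔ B
  irrelevant⇔⇒↔ irrA irrB A⇔B = mk↔ₛ′ (to A⇔B) (from A⇔B) (λ _ → irrB _ _) (λ _ → irrA _ _)

maxChain-window-step : ∀ {n} (b : Vec Bool n) → false ∈ᵛ b → MaxChain n (window 0 b) ↔
  (b ≡ replicate n false ⊎ Σ (Corner b) (λ c → MaxChain n (window 0 (removeCorner c))))
maxChain-window-step {n} b f∈b = ↔-trans (maxChain-step (window 0 b)) (isId ⊎-↔ viaCorners)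
  where
  w = window 0 b
  isId : T (isMaxChain n (w List.∷ List.[]) w) ↔ b ≡ replicate n false
  isId = irrelevant⇔⇒↔ T-irrelevant (λ { refl refl → refl }) (mk⇔
    (λ h → window-injective 0 b _ (trans (proj₁ (to (isMaxChain⇔ w List.[] w) h)) (idPerm≡window n)))
    (λ { refl → from (isMaxChain⇔ w List.[] w)
                  (sym (idPerm≡window n) , from (T-∧ {inX n w}) (inX-window b f∈b , _) , from (chainEndsAt-[]⇔ w w) refl) }))
  viaCorners = ↔-trans (↔-sym Σ-assoc) (↔-sym (Σ-↔ (corner↔covers b f∈b) ↔-refl))

unique⊆⇒length≤ : ∀ {xs ys : List ℕ} → Unique xs → xs ⊆ ys → length xs ≤ length ys
unique⊆⇒length≤ {[]} _ _ = z≤n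
unique⊆⇒length≤ {x ∷ xs} {ys} (x≢xs ∷ u) xs⊆ys with as , bs , refl ← ∈-∃++ (xs⊆ys (here refl)) =
  subst (suc (length xs) ≤_) (sym (↭-length (shift x as bs)))
        (s≤s (unique⊆⇒length≤ u λ {y} y∈xs → avoid (xs⊆ys (there y∈xs)) (All.lookup x≢xs y∈xs)))
  where
  avoid : ∀ {y} → y ∈ as ++ [ x ] ++ bs → x ≢ y → y ∈ as ++ bs
  avoid y∈ x≢y with ∈-++⁻ as y∈
  ... | inj₁ y∈as = ∈-++⁺ˡ y∈as
  ... | inj₂ (here refl) = ⊥-elim (x≢y refl)
  ... | inj₂ (there y∈bs) = ∈-++⁺ʳ as y∈bs

record Enumerates (N : ℕ) (xs : List ℕ) : Set where
  field
    length≡ : length xs ≡ N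
    unique : Unique xs
    inRange : All (λ x → 1 ≤ x × x ≤ N) xs
open Enumerates

usesEachOnce⇔Enumerates : ∀ {N xs} → T (usesEachOnce N xs) ⇔ Enumerates N xs
usesEachOnce⇔Enumerates {N} {xs} = mk⇔
  (λ h → let len , rest = to (T-∧ {⌊ length xs ℕ.≟ N ⌋}) h ; dist , range = to (T-∧ {distinct xs}) rest
         in record { length≡ = toWitness len ; unique = to distinct⇔Unique dist
                   ; inRange = All.map inRange⁺ (all⁺ _ xs range) })
  (λ e → from (T-∧ {⌊ length xs ℕ.≟ N ⌋}) (fromWitness (length≡ e) , from T-∧ (from distinct⇔Unique (unique e) ,
                                                      all⁻ _ (All.map inRange⁻ (inRange e)))))
  where
  open import Relation.Nullary.Decidable using (⌊_⌋)
  inRange⁺ : ∀ {x} → T ((0 <ℕᵇ x) ∧ ((x ℕ.∸ 1) <ℕᵇ N)) → 1 ≤ x × x ≤ N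
  inRange⁺ {suc x} h = s≤s z≤n , toWitness (proj₂ (to (T-∧ {0 <ℕᵇ suc x}) h))
  inRange⁻ : ∀ {x} → 1 ≤ x × x ≤ N → T ((0 <ℕᵇ x) ∧ ((x ℕ.∸ 1) <ℕᵇ N))
  inRange⁻ {suc x} (_ , x≤N) = fromWitness x≤N

Enumerates-resp-↭ : ∀ {N xs ys} → xs ↭ ys → Enumerates N xs → Enumerates N ys
Enumerates-resp-↭ {xs = xs} {ys} xs↭ys e = record
  { length≡ = trans (sym (↭-length xs↭ys)) (length≡ e)
  ; unique = PermutationSetoid.Unique-resp-↭ (setoid ℕ) (↭⇒↭ₛ xs↭ys) (unique e)
  ; inRange = All-resp-↭ xs↭ys (inRange e) }

Enumerates-∷⁺ : ∀ {M xs} → Enumerates M xs → Enumerates (suc M) (suc M ∷ xs)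
Enumerates-∷⁺ e = record
  { length≡ = cong suc (length≡ e)
  ; unique = All.map (λ (_ , x≤M) → ℕP.<⇒≢ (s≤s x≤M) ∘ sym) (inRange e) ∷ unique e
  ; inRange = (s≤s z≤n , ℕP.≤-refl) ∷ All.map (λ (1≤x , x≤M) → 1≤x , ℕP.m≤n⇒m≤1+n x≤M) (inRange e) }

Enumerates-∷⁻ : ∀ {M xs} → Enumerates (suc M) (suc M ∷ xs) → Enumerates M xs
Enumerates-∷⁻ e with M≢xs ∷ u ← unique e | _ ∷ range ← inRange e = record
  { length≡ = ℕP.suc-injective (length≡ e)
  ; unique = u
  ; inRange = All.zipWith (λ (≢x , (1≤x , x≤1+M)) → 1≤x , ℕP.≤-pred (ℕP.≤∧≢⇒< x≤1+M (≢x ∘ sym))) (M≢xs , range) }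

Enumerates-complete : ∀ {N xs v} → Enumerates N xs → 1 ≤ v → v ≤ N → v ∈ xs
Enumerates-complete {suc N′} {xs} {suc v} e _ v<N with suc v ∈? xs
... | yes v∈xs = v∈xs
... | no v∉xs = ⊥-elim (ℕP.1+n≰n (begin
    suc N′                    ≡⟨ sym (length≡ e) ⟩
    length xs                 ≤⟨ unique⊆⇒length≤ (unique e) xs⊆others ⟩
    length others             ≡⟨ ListP.length-++ (applyUpTo suc v) ⟩
    length (applyUpTo suc v) + length (applyUpTo (λ i → suc (suc v + i)) (suc N′ ∸ suc v))
                              ≡⟨ cong₂ _+_ (length-applyUpTo suc v) (length-applyUpTo _ (suc N′ ∸ suc v)) ⟩
    v + (N′ ∸ v)              ≡⟨ ℕP.m+[n∸m]≡n (ℕP.≤-pred v<N) ⟩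
    N′                        ∎))
  where
  open ℕP.≤-Reasoning
  N = suc N′
  others = applyUpTo suc v ++ applyUpTo (λ i → suc (suc v + i)) (N ∸ suc v)
  xs⊆others : xs ⊆ others
  xs⊆others {y} y∈xs with All.lookup (inRange e) y∈xs
  xs⊆others {suc y} y∈xs | _ , y≤N with ℕP.<-cmp y v
  ... | tri< y<v _ _ = ∈-++⁺ˡ (∈-applyUpTo⁺ suc y<v)
  ... | tri≈ _ refl _ = ⊥-elim (v∉xs y∈xs)
  ... | tri> _ _ v<y = ∈-++⁺ʳ (applyUpTo suc v)
        (subst (_∈ applyUpTo (λ i → suc (suc v + i)) (N ∸ suc v)) (cong suc (ℕP.m+[n∸m]≡n v<y))
               (∈-applyUpTo⁺ (λ i → suc (suc v + i)) (ℕP.∸-monoˡ-< y≤N v<y)))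

increasing⇔Linked : ∀ {r} → T (increasing r) ⇔ Linked _<_ r
increasing⇔Linked = mk⇔ to′ from′
  where
  to′ : ∀ {r} → T (increasing r) → Linked _<_ r
  to′ {[]} _ = []
  to′ {x ∷ []} _ = [-]
  to′ {x ∷ y ∷ r} h = let x<y , rest = to (T-∧ {x <ℕᵇ y}) h in toWitness x<y ∷ to′ rest
  from′ : ∀ {r} → Linked _<_ r → T (increasing r)
  from′ [] = _
  from′ [-] = _
  from′ (x<y ∷ rest) = from T-∧ (fromWitness x<y , from′ rest)

dropLast : ∀ {A : Set} → List A → List A
dropLast [] = []
dropLast (x ∷ []) = []
dropLast (x ∷ y ∷ r) = x ∷ dropLast (y ∷ r)

dropLast-∷ʳ : ∀ {A : Set} (r : List A) x → dropLast (r ∷ʳ x) ≡ r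
dropLast-∷ʳ [] x = refl
dropLast-∷ʳ (y ∷ []) x = refl
dropLast-∷ʳ (y ∷ z ∷ r) x = cong (y ∷_) (dropLast-∷ʳ (z ∷ r) x)

length-dropLast : ∀ {A : Set} (r : List A) → length (dropLast r) ≡ length r ∸ 1
length-dropLast [] = refl
length-dropLast (x ∷ []) = refl
length-dropLast (x ∷ y ∷ r) = cong suc (length-dropLast (y ∷ r))

dropLast-prefix : ∀ {A : Set} (r : List A) → Prefix _≡_ (dropLast r) r
dropLast-prefix [] = []
dropLast-prefix (x ∷ []) = []
dropLast-prefix (x ∷ y ∷ r) = refl ∷ dropLast-prefix (y ∷ r)

Linked-dropLast : ∀ {A : Set} {R : A → A → Set} {r} → Linked R r → Linked R (dropLast r)
Linked-dropLast [] = []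
Linked-dropLast [-] = []
Linked-dropLast (Rxy ∷ [-]) = [-]
Linked-dropLast (Rxy ∷ rest@(_ ∷ _)) = Rxy ∷ Linked-dropLast rest

Linked-∷ʳ : ∀ {r N} → Linked _<_ r → All (_< N) r → Linked _<_ (r ∷ʳ N)
Linked-∷ʳ {r} {N} inc r<N = LinkedP.++⁺ inc (lastConnected r r<N) [-]
  where
  lastConnected : ∀ r → All (_< N) r → Connected _<_ (last r) (Maybe.just N)
  lastConnected [] _ = nothing-just
  lastConnected (x ∷ []) (x<N ∷ _) = just x<N
  lastConnected (x ∷ y ∷ r) (_ ∷ r<N) = lastConnected (y ∷ r) r<N

max-is-last : ∀ {r N} → Linked _<_ r → All (_≤ N) r → N ∈ r → r ≡ dropLast r ∷ʳ N
max-is-last [-] _ (here refl) = refl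
max-is-last (x<y ∷ _) (_ ∷ y≤N ∷ _) (here refl) = ⊥-elim (ℕP.<-irrefl refl (ℕP.<-≤-trans x<y y≤N))
max-is-last {x ∷ y ∷ r} (_ ∷ inc) (_ ∷ r≤N) (there N∈) = cong (x ∷_) (max-is-last inc r≤N N∈)

_Above_ : List ℕ → List ℕ → Set
r Above r′ = All (uncurry _<_) (zip (drop 1 r) r′)

colsIncreasing⇔Linked : ∀ {t} → T (colsIncreasing t) ⇔ Linked _Above_ t
colsIncreasing⇔Linked = mk⇔ to′ from′
  where
  to′ : ∀ {t} → T (colsIncreasing t) → Linked _Above_ t
  to′ {[]} _ = []
  to′ {r ∷ []} _ = [-]
  to′ {r ∷ r′ ∷ t} h = let above , rest = to (T-∧ {all _ (zip (drop 1 r) r′)}) h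
                       in All.map toWitness (all⁺ _ _ above) ∷ to′ rest
  from′ : ∀ {t} → Linked _Above_ t → T (colsIncreasing t)
  from′ [] = _
  from′ [-] = _
  from′ (above ∷ rest) = from T-∧ (all⁻ _ (All.map fromWitness above) , from′ rest)

All-zip-prefix : ∀ {P : ℕ × ℕ → Set} {xs xs′ ys ys′ : List ℕ} → Prefix _≡_ xs′ xs → Prefix _≡_ ys′ ys →
                 All P (zip xs ys) → All P (zip xs′ ys′)
All-zip-prefix [] _ _ = []
All-zip-prefix (_ ∷ _) [] _ = []
All-zip-prefix (refl ∷ xs′≤xs) (refl ∷ ys′≤ys) (p ∷ ps) = p ∷ All-zip-prefix xs′≤xs ys′≤ys ps

Above-∷ʳ : ∀ r r′ N → r Above r′ → All (_< N) r → r Above (r′ ∷ʳ N)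
Above-∷ʳ r r′ N above r<N = go (drop 1 r) r′ above (drop-All r r<N)
  where
  drop-All : ∀ r → All (_< N) r → All (_< N) (drop 1 r)
  drop-All [] _ = []
  drop-All (_ ∷ _) (_ ∷ r<N) = r<N
  go : ∀ xs ys → All (uncurry _<_) (zip xs ys) → All (_< N) xs → All (uncurry _<_) (zip xs (ys ∷ʳ N))
  go [] ys _ _ = []
  go (x ∷ xs) [] _ (x<N ∷ _) = x<N ∷ zip-[] xs
    where
    zip-[] : ∀ xs → All (uncurry _<_) (zip xs [])
    zip-[] [] = []
    zip-[] (_ ∷ _) = []
  go (x ∷ xs) (y ∷ ys) (x<y ∷ above) (_ ∷ xs<N) = x<y ∷ go xs ys above xs<N

∷ʳ-Above : ∀ r r′ N → length r′ < length r → r Above r′ → (r ∷ʳ N) Above r′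
∷ʳ-Above (x ∷ r) r′ N r′<r above = subst (All (uncurry _<_)) (sym (zip-++ r r′ (ℕP.≤-pred r′<r))) above
  where
  zip-++ : ∀ xs ys → length ys ≤ length xs → zip (xs ∷ʳ N) ys ≡ zip xs ys
  zip-++ [] [] _ = refl
  zip-++ (x ∷ xs) [] _ = refl
  zip-++ (x ∷ xs) (y ∷ ys) (s≤s ys≤xs) = cong ((x , y) ∷_) (zip-++ xs ys ys≤xs)

dropLast-Above : ∀ r r′ → r Above r′ → dropLast r Above r′
dropLast-Above r r′ = All-zip-prefix (drop⁺ 1 (dropLast-prefix r)) (fromPointwise (Pointwise.refl refl))

Above-dropLast : ∀ r r′ → r Above r′ → r Above dropLast r′
Above-dropLast r r′ = All-zip-prefix (fromPointwise (Pointwise.refl refl)) (dropLast-prefix r′)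

entry-below : ∀ {x} r r′ → r Above r′ → length r ≤ suc (length r′) → x ∈ drop 1 r → ∃[ y ] y ∈ r′ × x < y
entry-below (_ ∷ xs) r′ above len x∈ = go xs r′ above (ℕP.≤-pred len) x∈
  where
  go : ∀ {x} xs ys → All (uncurry _<_) (zip xs ys) → length xs ≤ length ys → x ∈ xs → ∃[ y ] y ∈ ys × x < y
  go (x ∷ xs) (y ∷ ys) (x<y ∷ _) _ (here refl) = y , here refl , x<y
  go (x ∷ xs) (y ∷ ys) (_ ∷ above) (s≤s len) (there x∈) with z , z∈ , x<z ← go xs ys above len x∈ = z , there z∈ , x<z

last∈drop1 : ∀ {N} r → 2 ≤ length r → r ≡ dropLast r ∷ʳ N → N ∈ drop 1 r
last∈drop1 (x ∷ []) (s≤s ()) _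
last∈drop1 {N} (x ∷ y ∷ r) _ e = subst (λ (xs : List ℕ) → N ∈ xs) (sym (cong (drop 1) e)) (∈-++⁺ʳ {v = N} (dropLast (y ∷ r)) (here refl))

Tableau : Set
Tableau = List (List ℕ)

HasShape : List ℕ → Tableau → Set
HasShape = Pointwise (λ l r → length r ≡ l)

rowsHaveShape⇔HasShape : ∀ {λs t} → T (rowsHaveShape λs t) ⇔ HasShape λs t
rowsHaveShape⇔HasShape = mk⇔ to′ from′
  where
  to′ : ∀ {λs t} → T (rowsHaveShape λs t) → HasShape λs t
  to′ {[]} {[]} _ = []
  to′ {l ∷ λs} {r ∷ t} h = let r≡ , rest = to (T-∧ {⌊ length r ℕ.≟ l ⌋}) h in toWitness r≡ ∷ to′ rest
  from′ : ∀ {λs t} → HasShape λs t → T (rowsHaveShape λs t)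
  from′ [] = _
  from′ (r≡ ∷ rest) = from T-∧ (fromWitness r≡ , from′ rest)

record IsSYT (λs : List ℕ) (t : Tableau) : Set where
  field
    hasShape : HasShape λs t
    entries : Enumerates (sum λs) (concat t)
    rowsIncreasing : All (Linked _<_) t
    columnsIncreasing : Linked _Above_ t

isShiftedSYT⇔IsSYT : ∀ {λs t} → T (isShiftedSYT λs t) ⇔ IsSYT λs t
isShiftedSYT⇔IsSYT {λs} {t} = mk⇔
  (λ h → let sh , rest = to (T-∧ {rowsHaveShape λs t}) h
             en , rest′ = to (T-∧ {usesEachOnce (sum λs) (concat t)}) rest
             rows , cols = to (T-∧ {all increasing t}) rest′
         in record { hasShape = to rowsHaveShape⇔HasShape sh ; entries = to usesEachOnce⇔Enumerates en
                   ; rowsIncreasing = All.map (to increasing⇔Linked) (all⁺ _ t rows)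
                   ; columnsIncreasing = to colsIncreasing⇔Linked cols })
  (λ s → from T-∧ (from rowsHaveShape⇔HasShape (IsSYT.hasShape s) ,
         from T-∧ (from usesEachOnce⇔Enumerates (IsSYT.entries s) ,
         from T-∧ (all⁻ _ (All.map (from increasing⇔Linked) (IsSYT.rowsIncreasing s)) ,
                   from colsIncreasing⇔Linked (IsSYT.columnsIncreasing s)))))

-- On tableaux of the wrong shape both operations return junk.
removeCell : ∀ {k} {b : Vec Bool k} → Corner b → Tableau → Tableau
removeCell swapHere (r ∷ t) = dropLast r ∷ t
removeCell endHere (r ∷ t) = t
removeCell (next {x = true} c) (r ∷ t) = r ∷ removeCell c t
removeCell (next {x = false} c) t = removeCell c t
removeCell _ [] = []

addCell : ∀ {k} {b : Vec Bool k} → Corner b → ℕ → Tableau → Tableau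
addCell swapHere N (r ∷ t) = (r ∷ʳ N) ∷ t
addCell endHere N t = [ N ] ∷ t
addCell (next {x = true} c) N (r ∷ t) = r ∷ addCell c N t
addCell (next {x = false} c) N t = addCell c N t
addCell _ N [] = []

HasShape-removeCell : ∀ {k} {b : Vec Bool k} (c : Corner b) {t} →
                      HasShape (shape b) t → HasShape (shape (removeCorner c)) (removeCell c t)
HasShape-removeCell swapHere {r ∷ t} (r≡ ∷ rest) = trans (length-dropLast r) (cong (_∸ 1) r≡) ∷ rest
HasShape-removeCell endHere (_ ∷ rest) = rest
HasShape-removeCell (next {x = true} c) (r≡ ∷ rest) = r≡ ∷ HasShape-removeCell c rest
HasShape-removeCell (next {x = false} c) sh = HasShape-removeCell c sh

HasShape-addCell : ∀ {k} {b : Vec Bool k} (c : Corner b) N {t} →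
                   HasShape (shape (removeCorner c)) t → HasShape (shape b) (addCell c N t)
HasShape-addCell swapHere N {r ∷ t} (r≡ ∷ rest) = trans (length-++ r) (trans (ℕP.+-comm _ 1) (cong suc r≡)) ∷ rest
HasShape-addCell endHere N [] = refl ∷ []
HasShape-addCell (next {x = true} c) N (r≡ ∷ rest) = r≡ ∷ HasShape-addCell c N rest
HasShape-addCell (next {x = false} c) N sh = HasShape-addCell c N sh

removeCell-addCell : ∀ {k} {b : Vec Bool k} (c : Corner b) N {t} →
                     HasShape (shape (removeCorner c)) t → removeCell c (addCell c N t) ≡ t
removeCell-addCell swapHere N {r ∷ t} _ = cong (_∷ t) (dropLast-∷ʳ r N)
removeCell-addCell endHere N _ = refl
removeCell-addCell (next {x = true} c) N {r ∷ t} (_ ∷ rest) = cong (r ∷_) (removeCell-addCell c N rest)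
removeCell-addCell (next {x = false} c) N sh = removeCell-addCell c N sh

concat-addCell : ∀ {k} {b : Vec Bool k} (c : Corner b) N {t} →
                 HasShape (shape (removeCorner c)) t → concat (addCell c N t) ↭ N ∷ concat t
concat-addCell swapHere N {r ∷ t} _ = subst (_↭ N ∷ concat (r ∷ t)) (sym (++-assoc r [ N ] (concat t))) (shift N r (concat t))
concat-addCell endHere N _ = ↭-refl
concat-addCell (next {x = true} c) N {r ∷ t} (_ ∷ rest) = ↭-trans (++⁺ˡ r (concat-addCell c N rest)) (shift N r (concat t))
concat-addCell (next {x = false} c) N sh = concat-addCell c N sh

rows-removeCell : ∀ {k} {b : Vec Bool k} (c : Corner b) {t} →
                  All (Linked _<_) t → All (Linked _<_) (removeCell c t)
rows-removeCell swapHere (inc ∷ rest) = Linked-dropLast inc ∷ rest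
rows-removeCell endHere (_ ∷ rest) = rest
rows-removeCell (next {x = true} c) (inc ∷ rest) = inc ∷ rows-removeCell c rest
rows-removeCell (next {x = false} c) rows = rows-removeCell c rows
rows-removeCell swapHere [] = []
rows-removeCell endHere [] = []
rows-removeCell (next {x = true} c) [] = []

Small : ℕ → Tableau → Set
Small N t = All (All (_< N)) t

rows-addCell : ∀ {k} {b : Vec Bool k} (c : Corner b) N {t} → Small N t →
               All (Linked _<_) t → All (Linked _<_) (addCell c N t)
rows-addCell swapHere N (r<N ∷ _) (inc ∷ rest) = Linked-∷ʳ inc r<N ∷ rest
rows-addCell endHere N _ rows = [-] ∷ rows
rows-addCell (next {x = true} c) N (_ ∷ small) (inc ∷ rest) = inc ∷ rows-addCell c N small rest
rows-addCell (next {x = false} c) N small rows = rows-addCell c N small rows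
rows-addCell swapHere N [] [] = []
rows-addCell (next {x = true} c) N [] [] = []

private
  shape-row≤ : ∀ {k} (b : Vec Bool k) {r t} → HasShape (shape b) (r ∷ t) → length r ≤ k
  shape-row≤ (true ∷ b) (r≡ ∷ _) = ℕP.≤-reflexive r≡
  shape-row≤ (false ∷ b) sh = ℕP.m≤n⇒m≤1+n (shape-row≤ b sh)

  TopRow : List ℕ → Tableau → Set
  TopRow r t = Connected _Above_ (Maybe.just r) (List.head t)

above-removeCell : ∀ {k} {b : Vec Bool k} (c : Corner b) {r t} →
                   HasShape (shape b) t → TopRow r t → TopRow r (removeCell c t)
above-removeCell swapHere {r} {r′ ∷ _} _ (just above) = just (Above-dropLast r r′ above)
above-removeCell endHere (_ ∷ []) _ = just-nothing
above-removeCell (next {x = true} c) {t = _ ∷ _} _ above = above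
above-removeCell (next {x = false} c) sh above = above-removeCell c sh above

columns-removeCell : ∀ {k} {b : Vec Bool k} (c : Corner b) {t} →
                     HasShape (shape b) t → Linked _Above_ t → Linked _Above_ (removeCell c t)
columns-removeCell swapHere {r ∷ []} _ _ = [-]
columns-removeCell swapHere {r ∷ r′ ∷ t} _ (above ∷ cols) = dropLast-Above r r′ above ∷ cols
columns-removeCell endHere (_ ∷ []) _ = []
columns-removeCell (next {x = true} c) {r ∷ t} (_ ∷ sh) cols =
  above-removeCell c sh (head′ cols) ∷′ columns-removeCell c sh (Linked.tail cols)
columns-removeCell (next {x = false} c) sh cols = columns-removeCell c sh cols

above-addCell : ∀ {k} {b : Vec Bool k} (c : Corner b) N {r t} → All (_< N) r →
                HasShape (shape (removeCorner c)) t → TopRow r t → TopRow r (addCell c N t)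
above-addCell swapHere N {r} {r′ ∷ _} r<N _ (just above) = just (Above-∷ʳ r r′ N above r<N)
above-addCell endHere N {r} r<N _ _ = just (Above-∷ʳ r [] N (zip-[] (List.drop 1 r)) r<N)
  where
  zip-[] : ∀ xs → All _ (List.zip xs ([] {A = ℕ}))
  zip-[] [] = []
  zip-[] (_ ∷ _) = []
above-addCell (next {x = true} c) N {t = _ ∷ _} _ _ above = above
above-addCell (next {x = false} c) N r<N sh above = above-addCell c N r<N sh above

columns-addCell : ∀ {k} {b : Vec Bool k} (c : Corner b) N {t} → HasShape (shape (removeCorner c)) t →
                  Small N t → Linked _Above_ t → Linked _Above_ (addCell c N t)
columns-addCell swapHere N {r ∷ []} _ _ _ = [-]
columns-addCell (swapHere {b = b}) N {r ∷ r′ ∷ t} (r≡ ∷ sh) _ (above ∷ cols) =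
  ∷ʳ-Above r r′ N (ℕP.≤-<-trans (shape-row≤ b sh) (ℕP.≤-reflexive (sym r≡))) above ∷ cols
columns-addCell endHere N [] _ _ = [-]
columns-addCell (next {x = true} c) N {r ∷ t} (_ ∷ sh) (r<N ∷ small) cols =
  above-addCell c N r<N sh (head′ cols) ∷′ columns-addCell c N sh small (Linked.tail cols)
columns-addCell (next {x = false} c) N sh small cols = columns-addCell c N sh small cols

record MaxEntry {k} (b : Vec Bool k) (N : ℕ) (t : Tableau) : Set where
  field
    hasShape : HasShape (shape b) t
    max∈ : N ∈ concat t
    rowsIncreasing : All (Linked _<_) t
    columnsIncreasing : Linked _Above_ t
    bounded : All (All (_≤ N)) t
open MaxEntry

private
  MaxEntry-false : ∀ {k} {bs : Vec Bool k} {N t} → MaxEntry (false ∷ bs) N t → MaxEntry bs N t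
  MaxEntry-false m = record { hasShape = hasShape m ; max∈ = max∈ m ; rowsIncreasing = rowsIncreasing m
                            ; columnsIncreasing = columnsIncreasing m ; bounded = bounded m }

  MaxEntry-tail : ∀ {k} {bs : Vec Bool k} {N r t} → MaxEntry (true ∷ bs) N (r ∷ t) → N ∉ r → MaxEntry bs N t
  MaxEntry-tail {r = r} m N∉r = record
    { hasShape = Pointwise.tail (hasShape m)
    ; max∈ = either (⊥-elim ∘ N∉r) id (∈-++⁻ r (max∈ m))
    ; rowsIncreasing = All.tail (rowsIncreasing m)
    ; columnsIncreasing = Linked.tail (columnsIncreasing m)
    ; bounded = All.tail (bounded m) }

  -- N ends its row, and a second row of length one less would put an entry above N below it.
  max-not-above-row : ∀ {k} {bs : Vec Bool k} {N r t} → MaxEntry (true ∷ true ∷ bs) N (r ∷ t) → N ∉ r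
  max-not-above-row {t = []} m _ with _ ∷ () ← hasShape m
  max-not-above-row {k} {N = N} {r} {r′ ∷ t} m N∈r
    with r≡ ∷ r′≡ ∷ _ ← hasShape m | above ∷ _ ← columnsIncreasing m
    with y , y∈r′ , N<y ← entry-below r r′ above (ℕP.≤-reflexive (trans r≡ (cong suc (sym r′≡))))
                                     (last∈drop1 r (subst (2 ≤_) (sym r≡) (s≤s (s≤s z≤n)))
                                       (max-is-last (All.head (rowsIncreasing m)) (All.head (bounded m)) N∈r)) =
    ℕP.<-irrefl refl (ℕP.<-≤-trans N<y (All.lookup (All.head (All.tail (bounded m))) y∈r′))

cornerOf : ∀ {k} (b : Vec Bool k) {N t} → MaxEntry b N t → Corner b
cornerOf [] {t = []} m with () ← max∈ m
cornerOf (false ∷ b) m = next (cornerOf b (MaxEntry-false m))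
cornerOf (true ∷ b) {N} {r ∷ t} m with N ∈? r
... | no N∉r = next (cornerOf b (MaxEntry-tail m N∉r))
cornerOf (true ∷ []) m | yes _ = endHere
cornerOf (true ∷ false ∷ b) m | yes _ = swapHere
cornerOf (true ∷ true ∷ b) m | yes N∈r = ⊥-elim (max-not-above-row m N∈r)

addCell-removeCell : ∀ {k} (b : Vec Bool k) {N t} (m : MaxEntry b N t) →
                     addCell (cornerOf b m) N (removeCell (cornerOf b m) t) ≡ t
addCell-removeCell [] {t = []} m with () ← max∈ m
addCell-removeCell (false ∷ b) m = addCell-removeCell b (MaxEntry-false m)
addCell-removeCell (true ∷ b) {N} {r ∷ t} m with N ∈? r
... | no N∉r = cong (r ∷_) (addCell-removeCell b (MaxEntry-tail m N∉r))
addCell-removeCell (true ∷ []) {N} {r ∷ t} m | yes N∈r with r≡ ∷ _ ← hasShape m = cong (_∷ t) (singleton r r≡ N∈r)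
  where
  singleton : ∀ r → length r ≡ 1 → N ∈ r → [ N ] ≡ r
  singleton (_ ∷ []) _ (here refl) = refl
addCell-removeCell (true ∷ false ∷ b) {N} {r ∷ t} m | yes N∈r =
  cong (_∷ t) (sym (max-is-last (All.head (rowsIncreasing m)) (All.head (bounded m)) N∈r))
addCell-removeCell (true ∷ true ∷ b) m | yes N∈r = ⊥-elim (max-not-above-row m N∈r)

cornerOf-addCell : ∀ {k} {b : Vec Bool k} (c : Corner b) {N t} (m : MaxEntry b N (addCell c N t)) →
                   HasShape (shape (removeCorner c)) t → N ∉ concat t → cornerOf b m ≡ c
cornerOf-addCell swapHere {N} {r ∷ t} m _ _ with N ∈? (r ∷ʳ N)
... | yes _ = refl
... | no N∉ = ⊥-elim (N∉ (∈-++⁺ʳ r (here refl)))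
cornerOf-addCell endHere {N} m _ _ with N ∈? [ N ]
... | yes _ = refl
... | no N∉ = ⊥-elim (N∉ (here refl))
cornerOf-addCell (next {x = true} c) {N} {r ∷ t} m (_ ∷ sh) N∉ with N ∈? r
... | yes N∈r = ⊥-elim (N∉ (∈-++⁺ˡ N∈r))
... | no N∉r = cong next (cornerOf-addCell c (MaxEntry-tail m N∉r) sh (N∉ ∘ ∈-++⁺ʳ r))
cornerOf-addCell (next {x = false} c) m sh N∉ = cong next (cornerOf-addCell c (MaxEntry-false m) sh N∉)

sum-removeCorner : ∀ {k} {b : Vec Bool k} (c : Corner b) → suc (sum (shape (removeCorner c))) ≡ sum (shape b)
sum-removeCorner swapHere = refl
sum-removeCorner endHere = refl
sum-removeCorner {suc k} (next {x = true} c) = trans (sym (ℕP.+-suc (suc k) _)) (cong (_+_ (suc k)) (sum-removeCorner c))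
sum-removeCorner (next {x = false} c) = sum-removeCorner c

maxEntry : ∀ {k} (b : Vec Bool k) {t} → 0 < sum (shape b) → IsSYT (shape b) t → MaxEntry b (sum (shape b)) t
maxEntry b 0<N s = record
  { hasShape = IsSYT.hasShape s
  ; max∈ = Enumerates-complete (IsSYT.entries s) 0<N ℕP.≤-refl
  ; rowsIncreasing = IsSYT.rowsIncreasing s
  ; columnsIncreasing = IsSYT.columnsIncreasing s
  ; bounded = concat⁻ (All.map proj₂ (Enumerates.inRange (IsSYT.entries s))) }

IsSYT-removeCell : ∀ {k} (b : Vec Bool k) {t} (m : MaxEntry b (sum (shape b)) t) → IsSYT (shape b) t →
                   IsSYT (shape (removeCorner (cornerOf b m))) (removeCell (cornerOf b m) t)
IsSYT-removeCell b {t} m s = record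
  { hasShape = sh
  ; entries = Enumerates-∷⁻ (subst (λ N → Enumerates N (N ∷ rest)) (sym (sum-removeCorner c))
      (Enumerates-resp-↭ (subst (_↭ N ∷ rest) (cong concat (addCell-removeCell b m)) (concat-addCell c N sh))
                         (IsSYT.entries s)))
  ; rowsIncreasing = rows-removeCell c (IsSYT.rowsIncreasing s)
  ; columnsIncreasing = columns-removeCell c (IsSYT.hasShape s) (IsSYT.columnsIncreasing s) }
  where
  N = sum (shape b)
  c = cornerOf b m
  sh = HasShape-removeCell c (IsSYT.hasShape s)
  rest = concat (removeCell c t)

IsSYT-addCell : ∀ {k} {b : Vec Bool k} (c : Corner b) {t} → IsSYT (shape (removeCorner c)) t →
                IsSYT (shape b) (addCell c (sum (shape b)) t) × sum (shape b) ∉ concat t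
IsSYT-addCell {b = b} c {t} s = record
  { hasShape = HasShape-addCell c N (IsSYT.hasShape s)
  ; entries = Enumerates-resp-↭ (↭-sym (concat-addCell c N (IsSYT.hasShape s)))
                (subst (λ N → Enumerates N (N ∷ concat t)) (sum-removeCorner c) (Enumerates-∷⁺ (IsSYT.entries s)))
  ; rowsIncreasing = rows-addCell c N small (IsSYT.rowsIncreasing s)
  ; columnsIncreasing = columns-addCell c N (IsSYT.hasShape s) small (IsSYT.columnsIncreasing s) }
  , λ N∈ → ℕP.<-irrefl refl (All.lookup <N N∈)
  where
  N = sum (shape b)
  <N : All (_< N) (concat t)
  <N = All.map (λ (_ , x≤M) → subst (_ <_) (sum-removeCorner c) (s≤s x≤M)) (Enumerates.inRange (IsSYT.entries s))
  small : Small N t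
  small = concat⁻ <N

private
  ≡-syt : ∀ {λs} {x y : ShiftedSYT λs} → proj₁ x ≡ proj₁ y → x ≡ y
  ≡-syt {x = t , p} {.t , q} refl = cong (t ,_) (T-irrelevant p q)

  shape-allFalse : ∀ k → shape (replicate k false) ≡ []
  shape-allFalse zero = refl
  shape-allFalse (suc k) = shape-allFalse k

  sum-shape>0 : ∀ {k} (b : Vec Bool k) → b ≢ replicate k false → 0 < sum (shape b)
  sum-shape>0 [] b≢ = ⊥-elim (b≢ refl)
  sum-shape>0 (true ∷ b) _ = s≤s z≤n
  sum-shape>0 (false ∷ b) b≢ = sum-shape>0 b (b≢ ∘ cong (false ∷_))

  no-corner-allFalse : ∀ {k} → Corner (replicate k false) → ⊥
  no-corner-allFalse {suc k} (next c) = no-corner-allFalse c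

syt-step : ∀ {k} (b : Vec Bool k) → ShiftedSYT (shape b) ↔
           (b ≡ replicate k false ⊎ Σ (Corner b) (λ c → ShiftedSYT (shape (removeCorner c))))
syt-step {k} b = mk↔ₛ′ to′ from′ to∘from from∘to
  where
  N = sum (shape b)
  allFalse? = VecP.≡-dec Bool._≟_ b (replicate k false)
  Smaller = Σ (Corner b) (λ c → ShiftedSYT (shape (removeCorner c)))

  removeMax : ∀ {t} → b ≢ replicate k false → T (isShiftedSYT (shape b) t) → Smaller
  removeMax {t} b≢ p = let s = to isShiftedSYT⇔IsSYT p ; m = maxEntry b (sum-shape>0 b b≢) s in
    cornerOf b m , removeCell (cornerOf b m) t , from isShiftedSYT⇔IsSYT (IsSYT-removeCell b m s)

  to′ : ShiftedSYT (shape b) → b ≡ replicate k false ⊎ Smaller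
  to′ (t , p) with allFalse?
  ... | yes b≡ = inj₁ b≡
  ... | no b≢ = inj₂ (removeMax b≢ p)

  from′ : b ≡ replicate k false ⊎ Smaller → ShiftedSYT (shape b)
  from′ (inj₁ refl) = [] , subst (λ λs → T (isShiftedSYT λs [])) (sym (shape-allFalse k)) _
  from′ (inj₂ (c , t , p)) = addCell c N t , from isShiftedSYT⇔IsSYT (proj₁ (IsSYT-addCell c (to isShiftedSYT⇔IsSYT p)))

  to∘from : ∀ y → to′ (from′ y) ≡ y
  to∘from (inj₁ refl) with allFalse?
  ... | yes refl = refl
  ... | no b≢ = ⊥-elim (b≢ refl)
  to∘from (inj₂ (c , t , p)) with allFalse?
  ... | yes refl = ⊥-elim (no-corner-allFalse c)
  ... | no b≢ = cong inj₂ (same-corner _ (cornerOf-addCell c m (IsSYT.hasShape s) (proj₂ (IsSYT-addCell c s))) _)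
    where
    s = to isShiftedSYT⇔IsSYT p
    s′ = proj₁ (IsSYT-addCell c s)
    m = maxEntry b (sum-shape>0 b b≢) (to isShiftedSYT⇔IsSYT (from isShiftedSYT⇔IsSYT s′))
    same-corner : ∀ c′ → c′ ≡ c → ∀ q → (c′ , removeCell c′ (addCell c N t) , q) ≡ (c , t , p)
    same-corner c refl q = cong (c ,_) (≡-syt {shape (removeCorner c)} (removeCell-addCell c N (IsSYT.hasShape s)))

  from∘to : ∀ x → from′ (to′ x) ≡ x
  from∘to (t , p) with allFalse?
  ... | yes refl = ≡-syt {shape b} (sym (empty t (subst (λ λs → HasShape λs t) (shape-allFalse k)
                                              (IsSYT.hasShape (to (isShiftedSYT⇔IsSYT {shape b} {t}) p)))))
    where
    empty : ∀ t → HasShape [] t → t ≡ []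
    empty [] [] = refl
  ... | no b≢ = ≡-syt {shape b} (addCell-removeCell b (maxEntry b (sum-shape>0 b b≢) (to isShiftedSYT⇔IsSYT p)))

-- Induction on the size of the shape: both sides decompose over the corners of b.
maxChain↔SYT : ∀ m {n} (b : Vec Bool n) → sum (shape b) ≡ m → false ∈ᵛ b →
               MaxChain n (window 0 b) ↔ ShiftedSYT (shape b)
maxChain↔SYT m b size f∈b =
  ↔-trans (maxChain-window-step b f∈b) (↔-trans (↔-refl ⊎-↔ Σ-↔ ↔-refl (λ {c} → smaller m size c)) (↔-sym (syt-step b)))
  where
  smaller : ∀ m → sum (shape b) ≡ m → (c : Corner b) →
            MaxChain _ (window 0 (removeCorner c)) ↔ ShiftedSYT (shape (removeCorner c))
  smaller zero size c with () ← trans (sum-removeCorner c) size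
  smaller (suc m) size c = maxChain↔SYT m (removeCorner c) (suc-injective (trans (sum-removeCorner c) size))
                                         (false∈removeCorner c)

descentCount : ∀ {A : Set} → (A → ℤ) → List (A × A) → ℕ
descentCount f ps = length (filter (λ p → f (proj₂ p) ℤ.<? f (proj₁ p)) ps)

descentCount-++ : ∀ {A : Set} (f : A → ℤ) ps qs → descentCount f (ps ++ qs) ≡ descentCount f ps + descentCount f qs
descentCount-++ f ps qs = trans (cong length (ListP.filter-++ _ ps qs)) (ListP.length-++ (filter _ ps))

adjacentPairs : ∀ {A : Set} → List A → List (A × A)
adjacentPairs [] = []
adjacentPairs (x ∷ []) = []
adjacentPairs (x ∷ y ∷ r) = (x , y) ∷ adjacentPairs (y ∷ r)

private
  cyclicPairs≡ : ∀ (x : ℤ) xs → cyclicPairs (x ∷ xs) ≡ adjacentPairs (x ∷ xs ∷ʳ x)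
  cyclicPairs≡ x xs = go x xs x
    where
    go : ∀ {A : Set} (x : A) xs z → zip (x ∷ xs) (xs ∷ʳ z) ≡ adjacentPairs (x ∷ xs ∷ʳ z)
    go x [] z = refl
    go x (y ∷ ys) z = cong ((x , y) ∷_) (go y ys z)

  adjacentPairs-∷ʳ : ∀ {A : Set} (x : A) xs y z →
                     adjacentPairs (x ∷ xs ∷ʳ y ∷ʳ z) ≡ adjacentPairs (x ∷ xs ∷ʳ y) ∷ʳ (y , z)
  adjacentPairs-∷ʳ x [] y z = refl
  adjacentPairs-∷ʳ x (a ∷ xs) y z = cong ((x , a) ∷_) (adjacentPairs-∷ʳ a xs y z)

  elems-suc : ∀ n → elems (suc n) ≡ -[1+ n ] ∷ (elems n ∷ʳ + suc n)
  elems-suc n = begin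
    elems (suc n)
      ≡⟨ cong (λ ps′ → reverse (List.map -_ ps′) ++ ps′) posElems-suc ⟩
    reverse (List.map -_ (ps ∷ʳ + suc n)) ++ (ps ∷ʳ + suc n)
      ≡⟨ cong (λ xs → reverse xs ++ (ps ∷ʳ + suc n)) (ListP.map-++ -_ ps [ + suc n ]) ⟩
    reverse (List.map -_ ps ∷ʳ -[1+ n ]) ++ (ps ∷ʳ + suc n)
      ≡⟨ cong (_++ (ps ∷ʳ + suc n)) (ListP.reverse-++ (List.map -_ ps) [ -[1+ n ] ]) ⟩
    -[1+ n ] ∷ (reverse (List.map -_ ps) ++ (ps ∷ʳ + suc n))
      ≡⟨ cong (-[1+ n ] ∷_) (sym (ListP.++-assoc (reverse (List.map -_ ps)) ps [ + suc n ])) ⟩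
    -[1+ n ] ∷ (elems n ∷ʳ + suc n) ∎
    where
    open ≡-Reasoning
    ps = posElems n
    posElems-suc : posElems (suc n) ≡ ps ∷ʳ + suc n
    posElems-suc = trans (cong (List.map (λ k → + suc k)) (sym (ListP.upTo-∷ʳ n)))
                         (ListP.map-++ (λ k → + suc k) (upTo n) [ n ])

descentCount-[]-yes : ∀ {A : Set} (f : A → ℤ) {i j} → f j ℤ.< f i → descentCount f [ (i , j) ] ≡ 1
descentCount-[]-yes f {i} {j} lt = cong length (ListP.filter-accept (λ p → f (proj₂ p) ℤ.<? f (proj₁ p)) {xs = []} lt)

descentCount-[]-no : ∀ {A : Set} (f : A → ℤ) {i j} → ¬ f j ℤ.< f i → descentCount f [ (i , j) ] ≡ 0
descentCount-[]-no f {i} {j} ≮ = cong length (ListP.filter-reject (λ p → f (proj₂ p) ℤ.<? f (proj₁ p)) {xs = []} ≮)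

private
  linearDescents : (ℤ → ℤ) → ℕ → ℕ
  linearDescents f n = descentCount f (adjacentPairs (-[1+ n ] ∷ (elems n ∷ʳ + suc n)))

  descentCount-∷ : ∀ {A : Set} (f : A → ℤ) p ps → descentCount f (p ∷ ps) ≡ descentCount f [ p ] + descentCount f ps
  descentCount-∷ f p ps = descentCount-++ f [ p ] ps

  cdes-split : ∀ n f → cdes (suc n) f ≡ linearDescents f n + descentCount f [ (+ suc n , -[1+ n ]) ]
  cdes-split n f = begin
    cdes (suc n) f
      ≡⟨ cong (descentCount f ∘ cyclicPairs) (elems-suc n) ⟩
    descentCount f (cyclicPairs (-[1+ n ] ∷ (elems n ∷ʳ + suc n)))
      ≡⟨ cong (descentCount f) (cyclicPairs≡ -[1+ n ] (elems n ∷ʳ + suc n)) ⟩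
    descentCount f (adjacentPairs (-[1+ n ] ∷ elems n ∷ʳ + suc n ∷ʳ -[1+ n ]))
      ≡⟨ cong (descentCount f) (adjacentPairs-∷ʳ -[1+ n ] (elems n) (+ suc n) -[1+ n ]) ⟩
    descentCount f (adjacentPairs (-[1+ n ] ∷ elems n ∷ʳ + suc n) ∷ʳ (+ suc n , -[1+ n ]))
      ≡⟨ descentCount-++ f (adjacentPairs (-[1+ n ] ∷ elems n ∷ʳ + suc n)) _ ⟩
    linearDescents f n + descentCount f [ (+ suc n , -[1+ n ]) ] ∎
    where
    open ≡-Reasoning
    open import Function using (_∘_)

  linearDescents-suc : ∀ f n → linearDescents f (suc n) ≡
    descentCount f [ (-[1+ suc n ] , -[1+ n ]) ] + (linearDescents f n + descentCount f [ (+ suc n , + suc (suc n)) ])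
  linearDescents-suc f n = begin
    linearDescents f (suc n)
      ≡⟨ cong (λ es → descentCount f (adjacentPairs (-[1+ suc n ] ∷ (es ∷ʳ + suc (suc n))))) (elems-suc n) ⟩
    descentCount f ((-[1+ suc n ] , -[1+ n ]) ∷ adjacentPairs (-[1+ n ] ∷ elems n ∷ʳ + suc n ∷ʳ + suc (suc n)))
      ≡⟨ descentCount-∷ f _ _ ⟩
    descentCount f [ (-[1+ suc n ] , -[1+ n ]) ] + descentCount f (adjacentPairs (-[1+ n ] ∷ elems n ∷ʳ + suc n ∷ʳ + suc (suc n)))
      ≡⟨ cong (λ ps → descentCount f [ (-[1+ suc n ] , -[1+ n ]) ] + descentCount f ps)
              (adjacentPairs-∷ʳ -[1+ n ] (elems n) (+ suc n) (+ suc (suc n))) ⟩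
    descentCount f [ (-[1+ suc n ] , -[1+ n ]) ] + descentCount f (adjacentPairs (-[1+ n ] ∷ elems n ∷ʳ + suc n) ∷ʳ (+ suc n , + suc (suc n)))
      ≡⟨ cong (_+_ (descentCount f [ (-[1+ suc n ] , -[1+ n ]) ])) (descentCount-++ f (adjacentPairs (-[1+ n ] ∷ elems n ∷ʳ + suc n)) _) ⟩
    descentCount f [ (-[1+ suc n ] , -[1+ n ]) ] + (linearDescents f n + descentCount f [ (+ suc n , + suc (suc n)) ]) ∎
    where open ≡-Reasoning

  descentCount-[]-cong : ∀ {A B : Set} (f : A → ℤ) (g : B → ℤ) i j k l →
    (f j ℤ.< f i → g l ℤ.< g k) → (g l ℤ.< g k → f j ℤ.< f i) → descentCount f [ (i , j) ] ≡ descentCount g [ (k , l) ]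
  descentCount-[]-cong f g i j k l to from with f j ℤ.<? f i | g l ℤ.<? g k
  ... | yes _ | yes _ = refl
  ... | no _ | no _ = refl
  ... | yes p | no q = ⊥-elim (q (to p))
  ... | no p | yes q = ⊥-elim (p (from q))

steps : ℕ → ℕ → List (ℕ × ℕ)
steps a zero = []
steps a (suc m) = steps a m ∷ʳ (a + m , suc (a + m))

descents : (ℕ → ℤ) → ℕ → ℕ → ℕ
descents g a m = descentCount g (steps a m)

Antisymmetric : (ℤ → ℤ) → ℕ → Set
Antisymmetric f n = ∀ m → m ≤ n → f -[1+ m ] ≡ - f (+ suc m)

cdes≥descents : ∀ n f → Antisymmetric f n →
  2 * descents (λ j → f (+ j)) 1 n + descentCount f [ (+ suc n , -[1+ n ]) ] ≤ cdes (suc n) f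
cdes≥descents n f anti = subst (2 * descents g 1 n + W ≤_) (sym (cdes-split n f)) (ℕP.+-monoˡ-≤ W (linear n anti))
  where
  g = λ j → f (+ j)
  W = descentCount f [ (+ suc n , -[1+ n ]) ]
  linear : ∀ n → Antisymmetric f n → 2 * descents g 1 n ≤ linearDescents f n
  linear zero _ = z≤n
  linear (suc n) anti = begin
    2 * descents g 1 (suc n)
      ≡⟨ cong (2 *_) (descentCount-++ g (steps 1 n) _) ⟩
    2 * (descents g 1 n + R)
      ≡⟨ solve 2 (λ D R → con 2 :* (D :+ R) := R :+ (con 2 :* D :+ R)) refl (descents g 1 n) R ⟩
    R + (2 * descents g 1 n + R)
      ≤⟨ ℕP.+-mono-≤ (ℕP.≤-reflexive L≡R) (ℕP.+-mono-≤ (linear n (λ m m≤n → anti m (ℕP.m≤n⇒m≤1+n m≤n))) (ℕP.≤-reflexive R≡R′)) ⟩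
    L + (linearDescents f n + R′)
      ≡⟨ sym (linearDescents-suc f n) ⟩
    linearDescents f (suc n) ∎
    where
    open ℕP.≤-Reasoning
    open import Data.Nat.Solver using (module +-*-Solver)
    open +-*-Solver
    open import Function using (id)
    R = descentCount g [ (suc n , suc (suc n)) ]
    R′ = descentCount f [ (+ suc n , + suc (suc n)) ]
    L = descentCount f [ (-[1+ suc n ] , -[1+ n ]) ]
    R≡R′ : R ≡ R′
    R≡R′ = descentCount-[]-cong g f _ _ _ _ id id
    L≡R : R ≡ L
    L≡R = descentCount-[]-cong g f _ _ _ _
      (λ lt → subst₂ ℤ._<_ (sym (anti n (ℕP.n≤1+n n))) (sym (anti (suc n) ℕP.≤-refl)) (ℤP.neg-mono-< lt))
      (λ lt → ℤP.neg-cancel-< (subst₂ ℤ._<_ (anti n (ℕP.n≤1+n n)) (anti (suc n) ℕP.≤-refl) lt))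

private
  steps-+ : ∀ a m₁ m₂ → steps a (m₁ + m₂) ≡ steps a m₁ ++ steps (a + m₁) m₂
  steps-+ a m₁ zero = trans (cong (steps a) (ℕP.+-identityʳ m₁)) (sym (ListP.++-identityʳ (steps a m₁)))
  steps-+ a m₁ (suc m₂) = begin
    steps a (m₁ + suc m₂)                              ≡⟨ cong (steps a) (ℕP.+-suc m₁ m₂) ⟩
    steps a (m₁ + m₂) ∷ʳ (a + (m₁ + m₂) , _)           ≡⟨ cong (λ x → steps a (m₁ + m₂) ∷ʳ (x , suc x)) (sym (ℕP.+-assoc a m₁ m₂)) ⟩
    steps a (m₁ + m₂) ∷ʳ (a + m₁ + m₂ , _)             ≡⟨ cong (_∷ʳ (a + m₁ + m₂ , suc (a + m₁ + m₂))) (steps-+ a m₁ m₂) ⟩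
    (steps a m₁ ++ steps (a + m₁) m₂) ∷ʳ (a + m₁ + m₂ , _) ≡⟨ ListP.++-assoc (steps a m₁) _ _ ⟩
    steps a m₁ ++ steps (a + m₁) (suc m₂)              ∎
    where open ≡-Reasoning

descents-+ : ∀ g a m₁ m₂ → descents g a (m₁ + m₂) ≡ descents g a m₁ + descents g (a + m₁) m₂
descents-+ g a m₁ m₂ = trans (cong (descentCount g) (steps-+ a m₁ m₂)) (descentCount-++ g (steps a m₁) _)

drop⇒descent : ∀ g a m → g (a + m) ℤ.< g a → 1 ≤ descents g a m
drop⇒descent g a zero drop = ⊥-elim (ℤP.<-irrefl (cong g (ℕP.+-identityʳ a)) drop)
drop⇒descent g a (suc m) drop with g (suc (a + m)) ℤ.<? g (a + m)
... | yes lt = subst (1 ≤_) (sym (trans (descentCount-++ g (steps a m) _) (cong (_+_ (descents g a m)) (descentCount-[]-yes g lt))))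
                  (ℕP.m≤n+m 1 (descents g a m))
... | no ≮ = subst (1 ≤_) (sym (trans (descentCount-++ g (steps a m) _) (cong (_+_ (descents g a m)) (descentCount-[]-no g ≮))))
                 (ℕP.≤-trans (drop⇒descent g a m (ℤP.≤-<-trans (ℤP.≮⇒≥ ≮) (subst (λ k → g k ℤ.< g a) (ℕP.+-suc a m) drop)))
                             (ℕP.m≤m+n (descents g a m) 0))

descents-mono : ∀ g {a m i l} → a ≤ i → i + l ≤ a + m → descents g i l ≤ descents g a m
descents-mono g {a} {m} {i} {l} a≤i end≤ with x , refl ← ℕP.m≤n⇒∃[o]m+o≡n a≤i | z , e ← ℕP.m≤n⇒∃[o]m+o≡n end≤ =
  subst (λ m → descents g (a + x) l ≤ descents g a m) (m≡ e) (begin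
    descents g (a + x) l                                         ≤⟨ ℕP.m≤m+n _ _ ⟩
    descents g (a + x) l + descents g (a + x + l) z              ≡⟨ sym (descents-+ g (a + x) l z) ⟩
    descents g (a + x) (l + z)                                   ≤⟨ ℕP.m≤n+m _ _ ⟩
    descents g a x + descents g (a + x) (l + z)                  ≡⟨ sym (descents-+ g a x (l + z)) ⟩
    descents g a (x + (l + z))                                   ∎)
  where
  open ℕP.≤-Reasoning
  m≡ : a + x + l + z ≡ a + m → x + (l + z) ≡ m
  m≡ e = ℕP.+-cancelˡ-≡ a _ _ (trans (sym (trans (ℕP.+-assoc (a + x) l z) (ℕP.+-assoc a x (l + z)))) e)

drop-within : ∀ g {a m i j} → a ≤ i → i ≤ j → j ≤ a + m → g j ℤ.< g i → 1 ≤ descents g a m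
drop-within g {a} {m} {i} {j} a≤i i≤j j≤ drop with y , refl ← ℕP.m≤n⇒∃[o]m+o≡n i≤j =
  ℕP.≤-trans (drop⇒descent g i y drop) (descents-mono g a≤i j≤)

two-drops : ∀ g {a m i j k l} → a ≤ i → i ≤ j → j ≤ k → k ≤ l → l ≤ a + m →
            g j ℤ.< g i → g l ℤ.< g k → 2 ≤ descents g a m
two-drops g {a} {m} {i} {j} {k} {l} a≤i i≤j j≤k k≤l l≤ drop₁ drop₂
  with x , refl ← ℕP.m≤n⇒∃[o]m+o≡n (ℕP.≤-trans a≤i i≤j) =
  subst (2 ≤_) (sym (trans (cong (descents g a) (sym m≡)) (descents-+ g a x (m ∸ x))))
    (ℕP.+-mono-≤ (drop-within g a≤i i≤j ℕP.≤-refl drop₁)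
                 (drop-within g j≤k k≤l (subst (l ≤_) (sym a+x+[m∸x]) l≤) drop₂))
  where
  x≤m : x ≤ m
  x≤m = ℕP.+-cancelˡ-≤ a x m (ℕP.≤-trans (ℕP.≤-trans j≤k k≤l) l≤)
  m≡ : x + (m ∸ x) ≡ m
  m≡ = ℕP.m+[n∸m]≡n x≤m
  a+x+[m∸x] : a + x + (m ∸ x) ≡ a + m
  a+x+[m∸x] = trans (ℕP.+-assoc a x (m ∸ x)) (cong (_+_ a) m≡)

-- g lists the values w⁻¹(1), …, w⁻¹(n+1); W is the wrap-around term of cdes.
module FewDescents (g : ℕ → ℤ) (n W : ℕ) (bound : 2 * descents g 1 n + W ≤ 2)
                   (wrap : + 0 ℤ.< g (suc n) → 1 ≤ W) (g1>0 : + 0 ℤ.< g 1) where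

  private
    two-descents : 2 ≤ descents g 1 n → ⊥
    two-descents 2≤ = ℕP.<-irrefl refl (ℕP.≤-trans (ℕP.n≤1+n 3) (ℕP.≤-trans (ℕP.≤-trans (ℕP.*-monoʳ-≤ 2 2≤) (ℕP.m≤m+n _ W)) bound))

    descent-and-wrap : 1 ≤ descents g 1 n → + 0 ℤ.< g (suc n) → ⊥
    descent-and-wrap 1≤ g>0 = ℕP.<-irrefl refl (ℕP.≤-trans (ℕP.+-mono-≤ (ℕP.*-monoʳ-≤ 2 1≤) (wrap g>0)) bound)

  positives-increase : ∀ {j j′} → 1 ≤ j → j ≤ j′ → j′ ≤ suc n → + 0 ℤ.< g j′ → g j′ ℤ.< g j → ⊥
  positives-increase {j} {j′} 1≤j j≤j′ j′≤ g>0′ drop with + 0 ℤ.<? g (suc n)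
  ... | yes g>0 = descent-and-wrap (drop-within g 1≤j j≤j′ j′≤ drop) g>0
  ... | no ≯ = two-descents (two-drops g 1≤j j≤j′ ℕP.≤-refl j′≤ ℕP.≤-refl drop (ℤP.≤-<-trans (ℤP.≮⇒≥ ≯) g>0′))

  negatives-increase : ∀ {j j′} → 1 ≤ j → j ≤ j′ → j′ ≤ suc n → g j ℤ.< + 0 → g j′ ℤ.< g j → ⊥
  negatives-increase 1≤j j≤j′ j′≤ g<0 drop =
    two-descents (two-drops g ℕP.≤-refl 1≤j ℕP.≤-refl j≤j′ j′≤ (ℤP.<-trans g<0 g1>0) drop)

  positives-first : ∀ {j j′} → 1 ≤ j → j ≤ j′ → j′ ≤ suc n → g j ℤ.< + 0 → + 0 ℤ.< g j′ → ⊥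
  positives-first {j} {j′} 1≤j j≤j′ j′≤ g<0 g>0′ with + 0 ℤ.<? g (suc n)
  ... | yes g>0 = descent-and-wrap (drop-within g ℕP.≤-refl 1≤j (ℕP.≤-trans j≤j′ j′≤) (ℤP.<-trans g<0 g1>0)) g>0
  ... | no ≯ = two-descents (two-drops g ℕP.≤-refl 1≤j j≤j′ j′≤ ℕP.≤-refl (ℤP.<-trans g<0 g1>0)
                                        (ℤP.≤-<-trans (ℤP.≮⇒≥ ≯) g>0′))

-- In the window of an element of Y_n, an entry x precedes y only if |y| > x when x > 0,
-- and |y| < |x| when x < 0.
infix 4 _≺_
data _≺_ : ℤ → ℤ → Set where
  +≺ : ∀ {a y} → a < ∣ y ∣ → + a ≺ y
  -≺ : ∀ {a y} → ∣ y ∣ ≤ a → -[1+ a ] ≺ y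

≺-window : ∀ {k} p (w : Vec ℤ k) → AllPairs _≺_ (toList w) →
           All (λ x → p < ∣ x ∣ × ∣ x ∣ ≤ p + k) (toList w) →
           (∀ {v} → p < v → v ≤ p + k → v ∈ List.map ∣_∣ (toList w)) →
           w ≡ window p (Vec.map (_<ᵇ (+ 0)) w)
≺-window p [] _ _ _ = refl
≺-window p (+ zero ∷ w) _ ((() , _) ∷ _) _
≺-window {suc k} p (+ suc a ∷ w) (later ∷ pairs) ((p<1+a , _) ∷ range) covered =
  cong₂ _∷_ (cong +_ (sym 1+p≡1+a)) (≺-window (suc p) w pairs range′ covered′)
  where
  1+a<later : ∀ {y} → y ∈ toList w → suc a < ∣ y ∣
  1+a<later y∈ with +≺ lt ← All.lookup later y∈ = lt
  1+p≡1+a : suc p ≡ suc a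
  1+p≡1+a with covered (ℕP.n<1+n p) (subst (suc p ≤_) (sym (ℕP.+-suc p k)) (s≤s (ℕP.m≤m+n p k)))
  ... | here e = e
  ... | there v∈ with y , y∈ , e ← ∈-map⁻ ∣_∣ v∈ =
    ⊥-elim (ℕP.<-irrefl refl (ℕP.<-≤-trans (subst (suc a <_) (sym e) (1+a<later y∈)) p<1+a))
  range′ = All.tabulate λ {y} y∈ → subst (_< ∣ y ∣) (sym 1+p≡1+a) (1+a<later y∈) ,
                                   subst (∣ y ∣ ≤_) (ℕP.+-suc p k) (proj₂ (All.lookup range y∈))
  covered′ : ∀ {v} → suc p < v → v ≤ suc p + k → v ∈ List.map ∣_∣ (toList w)
  covered′ {v} 1+p<v v≤ with covered (ℕP.<-trans (ℕP.n<1+n p) 1+p<v) (subst (v ≤_) (sym (ℕP.+-suc p k)) v≤)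
  ... | here refl = ⊥-elim (ℕP.<-irrefl 1+p≡1+a 1+p<v)
  ... | there v∈ = v∈
≺-window {suc k} p (-[1+ a ] ∷ w) (later ∷ pairs) ((_ , 1+a≤) ∷ range) covered =
  cong₂ _∷_ (cong -[1+_] a≡p+k) (≺-window p w pairs range′ covered′)
  where
  later≤a : ∀ {y} → y ∈ toList w → ∣ y ∣ ≤ a
  later≤a y∈ with -≺ le ← All.lookup later y∈ = le
  a≡p+k : a ≡ p + k
  a≡p+k with covered (ℕP.m<m+n p (s≤s z≤n)) ℕP.≤-refl
  ... | here e = ℕP.suc-injective (trans (sym e) (ℕP.+-suc p k))
  ... | there v∈ with y , y∈ , e ← ∈-map⁻ ∣_∣ v∈ =
    ⊥-elim (ℕP.<-irrefl refl (ℕP.≤-<-trans (subst (_≤ a) (sym e) (later≤a y∈)) 1+a≤))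
  range′ = All.tabulate λ {y} y∈ → proj₁ (All.lookup range y∈) , subst (∣ y ∣ ≤_) a≡p+k (later≤a y∈)
  covered′ : ∀ {v} → p < v → v ≤ p + k → v ∈ List.map ∣_∣ (toList w)
  covered′ {v} p<v v≤ with covered p<v (subst (v ≤_) (sym (ℕP.+-suc p k)) (ℕP.m≤n⇒m≤1+n v≤))
  ... | here refl = ⊥-elim (ℕP.<-irrefl refl (subst (_≤ p + k) (cong suc a≡p+k) v≤))
  ... | there v∈ = v∈

nth-∈ : ∀ (xs : List ℤ) {k} → k < List.length xs → nth xs k ∈ xs
nth-∈ (x List.∷ xs) {zero} _ = here refl
nth-∈ (x List.∷ xs) {suc k} (s≤s k<) = there (nth-∈ xs k<)

∈⇒nth : ∀ {x} (xs : List ℤ) → x ∈ xs → ∃[ k ] k < List.length xs × nth xs k ≡ x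
∈⇒nth (y List.∷ xs) (here refl) = 0 , s≤s z≤n , refl
∈⇒nth (y List.∷ xs) (there x∈) with k , k< , e ← ∈⇒nth xs x∈ = suc k , s≤s k< , e

unique-∣nth∣-injective : ∀ (xs : List ℤ) → Unique (List.map ∣_∣ xs) → ∀ {k k′} →
  k < List.length xs → k′ < List.length xs → ∣ nth xs k ∣ ≡ ∣ nth xs k′ ∣ → k ≡ k′
unique-∣nth∣-injective (x List.∷ xs) _ {zero} {zero} _ _ _ = refl
unique-∣nth∣-injective (x List.∷ xs) (x≢ ∷ _) {zero} {suc k′} _ (s≤s k′<) e =
  ⊥-elim (All.lookup x≢ (Data.List.Membership.Propositional.Properties.∈-map⁺ ∣_∣ (nth-∈ xs k′<)) e)
unique-∣nth∣-injective (x List.∷ xs) (x≢ ∷ _) {suc k} {zero} (s≤s k<) _ e =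
  ⊥-elim (All.lookup x≢ (Data.List.Membership.Propositional.Properties.∈-map⁺ ∣_∣ (nth-∈ xs k<)) (sym e))
unique-∣nth∣-injective (x List.∷ xs) (_ ∷ u) {suc k} {suc k′} (s≤s k<) (s≤s k′<) e =
  cong suc (unique-∣nth∣-injective xs u k< k′< e)

findFirst-unique : ∀ (p : ℤ → Bool) xs {y} → y ∈ xs → T (p y) → (∀ {z} → z ∈ xs → T (p z) → z ≡ y) →
                   findFirst p xs ≡ y
findFirst-unique p (x List.∷ xs) y∈ py unique with p x in eq
... | true = unique (here refl) (subst T (sym eq) _)
... | false with y∈
...   | here refl = ⊥-elim (subst T eq py)
...   | there y∈xs = findFirst-unique p xs y∈xs py (unique ∘ there)
  where open import Function using (_∘_)

module InX {n : ℕ} (w : Vec ℤ n) (w∈X : T (inX n w)) where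

  ws : List ℤ
  ws = toList w

  f : ℤ → ℤ
  f = inverse n ws

  private
    signedPerm = proj₁ (to (T-∧ {isSignedPerm n ws}) w∈X)
    rest = proj₂ (to (T-∧ {⌊ List.length ws ℕ.≟ n ⌋}) signedPerm)

  length-ws : List.length ws ≡ n
  length-ws = toWitness (proj₁ (to (T-∧ {⌊ List.length ws ℕ.≟ n ⌋}) signedPerm))

  1∈ws : + 1 ∈ ws
  1∈ws = to ∈ᵇ⇔∈ (proj₂ (to (T-∧ {isSignedPerm n ws}) w∈X))

  abs-unique : Unique (List.map ∣_∣ ws)
  abs-unique = to distinct⇔Unique (proj₂ (to (T-∧ {all (λ x → x ∈ᵇ elems n) ws}) rest))

  entry-∈ : ∀ {x} → x ∈ ws → ∃[ m ] m < n × x ≡±[1+ m ]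
  entry-∈ x∈ = to (∈-elems⇔ {n}) (to ∈ᵇ⇔∈ (All.lookup (all⁺ _ ws (proj₁ (to (T-∧ {all (λ x → x ∈ᵇ elems n) ws}) rest))) x∈))

  entry : ∀ {k} → k < n → ∃[ m ] m < n × nth ws k ≡±[1+ m ]
  entry k< = entry-∈ (nth-∈ ws (subst (_ <_) (sym length-ws) k<))

  position-injective : ∀ {k k′} → k < n → k′ < n → ∣ nth ws k ∣ ≡ ∣ nth ws k′ ∣ → k ≡ k′
  position-injective k< k′< = unique-∣nth∣-injective ws abs-unique (subst (_ <_) (sym length-ws) k<)
                                                                    (subst (_ <_) (sym length-ws) k′<)

  private
    nonzero : ∀ {k} → k < n → nth ws k ≢ - nth ws k
    nonzero {k} k< with nth ws k | entry k<
    ... | _ | _ , _ , pos = λ ()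
    ... | _ | _ , _ , neg = λ ()

    -∣∣ : ∀ x → ∣ - x ∣ ≡ ∣ x ∣
    -∣∣ = ℤP.∣-i∣≡∣i∣

  eval-injective : ∀ {z z′} → z ∈ elems n → z′ ∈ elems n → eval ws z ≡ eval ws z′ → z ≡ z′
  eval-injective z∈ z′∈ e with to (∈-elems⇔ {n}) z∈ | to (∈-elems⇔ {n}) z′∈
  ... | m , m< , pos | m′ , m′< , pos = cong (λ m → + suc m) (position-injective m< m′< (cong ∣_∣ e))
  ... | m , m< , neg | m′ , m′< , neg =
    cong -[1+_] (position-injective m< m′< (trans (sym (-∣∣ (nth ws m))) (trans (cong ∣_∣ e) (-∣∣ (nth ws m′)))))
  ... | m , m< , pos | m′ , m′< , neg with refl ← position-injective m< m′< (trans (cong ∣_∣ e) (-∣∣ (nth ws m′))) =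
    ⊥-elim (nonzero m< e)
  ... | m , m< , neg | m′ , m′< , pos with refl ← position-injective m< m′< (trans (sym (-∣∣ (nth ws m))) (cong ∣_∣ e)) =
    ⊥-elim (nonzero m< (sym e))

  f-eval : ∀ {z} → z ∈ elems n → f (eval ws z) ≡ z
  f-eval {z} z∈ = findFirst-unique _ (elems n) z∈ (fromWitness refl)
                                   (λ z′∈ h → eval-injective z′∈ z∈ (toWitness h))

  f-nth : ∀ {k} → k < n → f (nth ws k) ≡ + suc k
  f-nth k< = f-eval (from (∈-elems⇔ {n}) (_ , k< , pos))

  f-negnth : ∀ {k} → k < n → f (- nth ws k) ≡ -[1+ k ]
  f-negnth k< = f-eval (from (∈-elems⇔ {n}) (_ , k< , neg))

  private
    abs-enumerates : Enumerates n (List.map ∣_∣ ws)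
    abs-enumerates = record
      { length≡ = trans (ListP.length-map ∣_∣ ws) length-ws
      ; unique = abs-unique
      ; inRange = AllP.map⁺ (All.tabulate in-range) }
      where
      in-range : ∀ {x} → x ∈ ws → 1 ≤ ∣ x ∣ × ∣ x ∣ ≤ n
      in-range x∈ with entry-∈ x∈
      ... | m , m< , pos = s≤s z≤n , m<
      ... | m , m< , neg = s≤s z≤n , m<

  abs-covered : ∀ {v} → 1 ≤ v → v ≤ n → ∃[ k ] k < n × ∣ nth ws k ∣ ≡ v
  abs-covered 1≤v v≤n
    with x , x∈ , refl ← ∈-map⁻ ∣_∣ (Enumerates-complete abs-enumerates 1≤v v≤n)
    with k , k< , refl ← ∈⇒nth ws x∈ = k , subst (k <_) length-ws k< , refl

  antisymmetric : ∀ m → m < n → f -[1+ m ] ≡ - f (+ suc m)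
  antisymmetric m m< with k , k< , abs≡ ← abs-covered (s≤s z≤n) m<
    with nth ws k | entry k< | f-nth k< | f-negnth k< | abs≡
  ... | _ | _ , _ , pos | fx | f-x | refl = trans f-x (cong -_ (sym fx))
  ... | _ | _ , _ , neg | fx | f-x | refl = trans fx (cong -_ (sym f-x))

private
  applyUpTo-nth : ∀ (xs : List ℤ) → xs ≡ List.applyUpTo (nth xs) (List.length xs)
  applyUpTo-nth List.[] = refl
  applyUpTo-nth (x List.∷ xs) = cong (x List.∷_) (applyUpTo-nth xs)

module InY (n′ : ℕ) (w : Vec ℤ (suc n′)) (w∈Y : T (inY (suc n′) w)) where

  open InX w (proj₁ (to (T-∧ {inX (suc n′) w}) w∈Y))

  private
    g : ℕ → ℤ
    g j = f (+ j)

    W = descentCount f [ (+ suc n′ , -[1+ n′ ]) ]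

    bound : 2 * descents g 1 n′ + W ≤ 2
    bound = ℕP.≤-trans (cdes≥descents n′ f (λ m m≤ → antisymmetric m (s≤s m≤)))
                       (toWitness (proj₂ (to (T-∧ {inX (suc n′) w}) w∈Y)))

    wrap : + 0 ℤ.< g (suc n′) → 1 ≤ W
    wrap g>0 = ℕP.≤-reflexive (sym (descentCount-[]-yes f
      (subst (ℤ._< g (suc n′)) (sym (antisymmetric n′ ℕP.≤-refl)) (ℤP.<-trans (ℤP.neg-mono-< g>0) g>0))))

    g1>0 : + 0 ℤ.< g 1
    g1>0 with k , k< , e ← ∈⇒nth ws 1∈ws =
      subst (+ 0 ℤ.<_) (trans (sym (f-nth (subst (k <_) length-ws k<))) (cong f e)) (ℤ.+<+ (s≤s z≤n))

  open FewDescents g n′ W bound wrap g1>0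

  private
    positive : ∀ {j i} → g j ≡ + suc i → + 0 ℤ.< g j
    positive e = subst (+ 0 ℤ.<_) (sym e) (ℤ.+<+ (s≤s z≤n))

    negative : ∀ {j i} → g j ≡ -[1+ i ] → g j ℤ.< + 0
    negative e = subst (ℤ._< + 0) (sym e) ℤ.-<+

  precedes : ∀ {k k′} → k < k′ → k′ < suc n′ → nth ws k ≺ nth ws k′
  precedes {k} {k′} k<k′ k′<
    with nth ws k | entry (ℕP.<-trans k<k′ k′<) | f-nth (ℕP.<-trans k<k′ k′<) | f-negnth (ℕP.<-trans k<k′ k′<)
       | nth ws k′ | entry k′< | f-nth k′< | f-negnth k′< | position-injective (ℕP.<-trans k<k′ k′<) k′<
  ... | _ | a , a< , pos | fx | _ | _ | b , b< , pos | fy | _ | inj with ℕP.<-cmp a b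
  ...   | tri< a<b _ _ = +≺ (s≤s a<b)
  ...   | tri≈ _ refl _ = ⊥-elim (ℕP.<-irrefl (inj refl) k<k′)
  ...   | tri> _ _ b<a = ⊥-elim (positives-increase (s≤s z≤n) (ℕP.<⇒≤ (s≤s b<a)) a<
      (positive fx) (subst₂ ℤ._<_ (sym fx) (sym fy) (ℤ.+<+ (s≤s k<k′))))
  precedes {k} {k′} k<k′ k′< | _ | a , a< , pos | fx | _ | _ | b , b< , neg | _ | f-y | inj with ℕP.<-cmp a b
  ...   | tri< a<b _ _ = +≺ (s≤s a<b)
  ...   | tri≈ _ refl _ = ⊥-elim (ℕP.<-irrefl (inj refl) k<k′)
  ...   | tri> _ _ b<a = ⊥-elim (positives-first (s≤s z≤n) (ℕP.<⇒≤ (s≤s b<a)) a< (negative f-y) (positive fx))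
  precedes {k} {k′} k<k′ k′< | _ | a , a< , neg | _ | f-x | _ | b , b< , pos | fy | _ | inj with ℕP.<-cmp a b
  ...   | tri> _ _ b<a = -≺ b<a
  ...   | tri≈ _ refl _ = ⊥-elim (ℕP.<-irrefl (inj refl) k<k′)
  ...   | tri< a<b _ _ = ⊥-elim (positives-first (s≤s z≤n) (ℕP.<⇒≤ (s≤s a<b)) b< (negative f-x) (positive fy))
  precedes {k} {k′} k<k′ k′< | _ | a , a< , neg | _ | f-x | _ | b , b< , neg | _ | f-y | inj with ℕP.<-cmp a b
  ...   | tri> _ _ b<a = -≺ b<a
  ...   | tri≈ _ refl _ = ⊥-elim (ℕP.<-irrefl (inj refl) k<k′)
  ...   | tri< a<b _ _ = ⊥-elim (negatives-increase (s≤s z≤n) (ℕP.<⇒≤ (s≤s a<b)) b< (negative f-x)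
      (subst₂ ℤ._<_ (sym f-y) (sym f-x) (ℤ.-<- k<k′)))


  w≡window : w ≡ window 0 (Vec.map (_<ᵇ (+ 0)) w)
  w≡window = ≺-window 0 w pairs range covered
    where
    pairs : AllPairs _≺_ ws
    pairs = subst (AllPairs _≺_) (sym (applyUpTo-nth ws))
      (AllPairsP.applyUpTo⁺₁ (nth ws) (List.length ws) (λ k<k′ k′< → precedes k<k′ (subst (_ <_) length-ws k′<)))
    range : All (λ x → 0 < ∣ x ∣ × ∣ x ∣ ≤ suc n′) ws
    range = All.tabulate λ x∈ → case entry-∈ x∈ of λ where
      (m , m< , pos) → s≤s z≤n , m<
      (m , m< , neg) → s≤s z≤n , m<
    covered : ∀ {v} → 0 < v → v ≤ suc n′ → v ∈ List.map ∣_∣ ws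
    covered 0<v v≤ with k , k< , refl ← abs-covered 0<v v≤ =
      Data.List.Membership.Propositional.Properties.∈-map⁺ ∣_∣ (nth-∈ ws (subst (k <_) (sym length-ws) k<))

inY⇒window : ∀ n (w : Vec ℤ n) → T (inY n w) → Σ (Vec Bool n) (λ b → w ≡ window 0 b)
inY⇒window zero [] ()
inY⇒window (suc n′) w w∈Y = _ , InY.w≡window n′ w w∈Y

corollary9p3 : (n : ℕ) (w : Vec ℤ n) → T (inY n w) → MaxChain n w ↔ ShiftedSYT (lam n w)
corollary9p3 n w w∈Y with inY⇒window n w w∈Y
... | b , refl = subst (λ λs → MaxChain n (window 0 b) ↔ ShiftedSYT λs) (sym (lam-window b))
                       (maxChain↔SYT _ b refl (to (+suc∈window⇔ 0 b) (to ∈ᵇ⇔∈ 1∈w)))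
  where
  1∈w = proj₂ (to (T-∧ {isSignedPerm n (toList (window 0 b))}) (proj₁ (to (T-∧ {inX n (window 0 b)}) w∈Y)))
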